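{- Let $G$ be an MP-tree and let $M_G$ be its multipath matroid, with rank function $r$. Then for every non-negative integer $k$, $$k\,T_{M_G}(1-k,0)=(-1)^{r(E(G))}\,\tau_G(k).$$
   Context: Digraphs: finite, at most one edge $(v,w)$ from $v$ to $w$ for distinct $v,w$. A multipath is a spanning subgraph each of whose connected components is a vertex or a simple path (sequence of non-loop edges with target of each = source of next, no repeated vertex, not closing into a cycle); $\mathrm{Mult}(G)$ is the set of multipaths (as edge sets); $M_G=(E(G),\mathrm{Mult}(G))$. An MP-digraph satisfies (MP1) no subgraph isomorphic to $D_A$ (vertices $v_0,v_1,v_2$, edges $(v_1,v_0),(v_0,v_2),(v_1,v_2)$) or $D_B$ (vertices $v_0,\dots,v_3$, edges $(v_0,v_1),(v_2,v_1),(v_2,v_3)$) or their edge-reversals, and (MP2) every coherently oriented cycle of length $\ge2$ is a connected component; then $M_G$ is a matroid, with rank $r(A)$ the largest size of a multipath inside $A$. An MP-tree is an MP-digraph whose underlying undirected graph is a tree. Tutte polynomial: $T_M(x,y)=\sum_{A\subseteq X}(x-1)^{r(X)-r(A)}(y-1)^{|A|-r(A)}$. A flowing $k$-colouring of a digraph $H$ is a map $c:V(H)\to\{1,\dots,k\}$ with $c(v)\neq c(w)$ for each edge $(v,w)$, $c(v)=c(v')$ whenever $(v,w),(v',w)$ are edges, and $c(v)=c(v')$ whenever $(w,v),(w,v')$ are edges; $\tau_H(k)$ is the number of flowing $k$-colourings. -}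

module Defs where

open import Data.Nat using (ℕ; zero; suc; _∸_; _≤_; _≥_)
open import Data.Integer as ℤ using (ℤ; +_; -_; -[1+_])
open import Data.Fin using (Fin; _≟_)
open import Data.Product using (_×_; _,_; proj₁; proj₂; ∃; ∃-syntax; Σ-syntax)
open import Data.Sum using (_⊎_)
open import Data.List using (List; []; _∷_; _++_; [_]; length; map; concatMap; zip; filter; foldr)
open import Data.List.Membership.Propositional using (_∈_)
open import Data.List.Relation.Unary.All using (All; all?)
open import Data.List.Relation.Unary.Unique.Propositional using (Unique)
open import Data.List.Relation.Binary.Sublist.Propositional using (_⊆_)
open import Data.Vec using (Vec; lookup)
import Data.Vec as Vec
open import Relation.Binary.PropositionalEquality using (_≡_; _≢_)
open import Relation.Nullary using (¬_; Dec)
open import Relation.Nullary.Decidable using (¬?; _×-dec_; _→-dec_)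

-- Digraphs on vertex set Fin n; edges given as a duplicate-free list of
-- ordered pairs (v , w) = edge from v to w, with no loops.

Edge : ℕ → Set
Edge n = Fin n × Fin n

record Digraph : Set where
  field
    n       : ℕ
    E       : List (Edge n)
    unique  : Unique E
    noLoops : All (λ e → proj₁ e ≢ proj₂ e) E
open Digraph public

module _ {n : ℕ} where

  -- Multipaths (edge sets S of a spanning subgraph whose components are
  -- isolated vertices or simple directed paths): every vertex has
  -- in-degree ≤ 1 and out-degree ≤ 1 in S, and S has no directed closed
  -- walk of positive length (i.e. no coherently oriented cycle).

  data DWalk (S : List (Edge n)) : Fin n → Fin n → ℕ → Set where
    here : ∀ {v} → DWalk S v v zero
    step : ∀ {u v w m} → (u , v) ∈ S → DWalk S v w m → DWalk S u w (suc m)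

  HasDirectedCycle : List (Edge n) → Set
  HasDirectedCycle S = ∃[ v ] ∃[ m ] DWalk S v v (suc m)

  InDeg≤1 : List (Edge n) → Set
  InDeg≤1 S = ∀ {e e'} → e ∈ S → e' ∈ S → proj₂ e ≡ proj₂ e' → e ≡ e'

  OutDeg≤1 : List (Edge n) → Set
  OutDeg≤1 S = ∀ {e e'} → e ∈ S → e' ∈ S → proj₁ e ≡ proj₁ e' → e ≡ e'

  IsMultipath : List (Edge n) → Set
  IsMultipath S = InDeg≤1 S × OutDeg≤1 S × ¬ HasDirectedCycle S

  ContainsDA : List (Edge n) → Set
  ContainsDA E = ∃[ v0 ] ∃[ v1 ] ∃[ v2 ]
    (v0 ≢ v1 × v0 ≢ v2 × v1 ≢ v2 ×
     (v1 , v0) ∈ E × (v0 , v2) ∈ E × (v1 , v2) ∈ E)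

  ContainsDArev : List (Edge n) → Set
  ContainsDArev E = ∃[ v0 ] ∃[ v1 ] ∃[ v2 ]
    (v0 ≢ v1 × v0 ≢ v2 × v1 ≢ v2 ×
     (v0 , v1) ∈ E × (v2 , v0) ∈ E × (v2 , v1) ∈ E)

  ContainsDB : List (Edge n) → Set
  ContainsDB E = ∃[ v0 ] ∃[ v1 ] ∃[ v2 ] ∃[ v3 ]
    (v0 ≢ v1 × v0 ≢ v2 × v0 ≢ v3 × v1 ≢ v2 × v1 ≢ v3 × v2 ≢ v3 ×
     (v0 , v1) ∈ E × (v2 , v1) ∈ E × (v2 , v3) ∈ E)

  ContainsDBrev : List (Edge n) → Set
  ContainsDBrev E = ∃[ v0 ] ∃[ v1 ] ∃[ v2 ] ∃[ v3 ]
    (v0 ≢ v1 × v0 ≢ v2 × v0 ≢ v3 × v1 ≢ v2 × v1 ≢ v3 × v2 ≢ v3 ×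
     (v1 , v0) ∈ E × (v1 , v2) ∈ E × (v3 , v2) ∈ E)

  MP1 : List (Edge n) → Set
  MP1 E = ¬ ContainsDA E × ¬ ContainsDArev E × ¬ ContainsDB E × ¬ ContainsDBrev E

  -- A coherently oriented cycle is given by a duplicate-free
  -- list of vertices v0 … v(m-1), m ≥ 2, with edges (vi , v(i+1 mod m)).

  cycleEdges : List (Fin n) → List (Edge n)
  cycleEdges []       = []
  cycleEdges (v ∷ vs) = zip (v ∷ vs) (vs ++ [ v ])

  IsCoherentCycle : List (Edge n) → List (Fin n) → Set
  IsCoherentCycle E C = length C ≥ 2 × Unique C × All (_∈ E) (cycleEdges C)

  -- the cycle (vertex set C, edges cycleEdges C) is a connected component:
  -- every edge of E touching a vertex of C is one of the cycle's edges
  IsComponent : List (Edge n) → List (Fin n) → Set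
  IsComponent E C = ∀ {e} → e ∈ E → (proj₁ e ∈ C ⊎ proj₂ e ∈ C) → e ∈ cycleEdges C

  MP2 : List (Edge n) → Set
  MP2 E = ∀ C → IsCoherentCycle E C → IsComponent E C

  Adj : List (Edge n) → Fin n → Fin n → Set
  Adj E v w = (v , w) ∈ E ⊎ (w , v) ∈ E

  data UWalk (E : List (Edge n)) : Fin n → Fin n → Set where
    here : ∀ {v} → UWalk E v v
    step : ∀ {u v w} → Adj E u v → UWalk E v w → UWalk E u w

  Connected : List (Edge n) → Set
  Connected E = ∀ v w → UWalk E v w

  HasUndirectedCycle : List (Edge n) → Set
  HasUndirectedCycle E = ∃[ C ] (length C ≥ 3 × Unique C ×
                                 All (λ e → Adj E (proj₁ e) (proj₂ e)) (cycleEdges C))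

  IsTree : List (Edge n) → Set
  IsTree E = 1 ≤ n × Connected E × ¬ HasUndirectedCycle E

IsMPDigraph : Digraph → Set
IsMPDigraph G = MP1 (E G) × MP2 (E G)

IsMPTree : Digraph → Set
IsMPTree G = IsMPDigraph G × IsTree (E G)

-- Rank function of M_G: r(A) = largest size of a multipath contained in A,
-- for every A ⊆ E(G).  (Edge subsets are sublists of the duplicate-free
-- list E(G).)

IsMultipathRank : (G : Digraph) → (List (Edge (n G)) → ℕ) → Set
IsMultipathRank G r = ∀ A → A ⊆ E G →
  (∃[ B ] (B ⊆ A × IsMultipath B × length B ≡ r A)) ×
  (∀ B → B ⊆ A → IsMultipath B → length B ≤ r A)

subsets : ∀ {A : Set} → List A → List (List A)
subsets []       = [ [] ]
subsets (x ∷ xs) = let s = subsets xs in s ++ map (x ∷_) s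

sumℤ : List ℤ → ℤ
sumℤ = foldr ℤ._+_ (+ 0)

tutte : (G : Digraph) → (List (Edge (n G)) → ℕ) → ℤ → ℤ → ℤ
tutte G r x y = sumℤ (map term (subsets (E G)))
  where
  term : List (Edge (n G)) → ℤ
  term A = ((x ℤ.- + 1) ℤ.^ (r (E G) ∸ r A)) ℤ.* ((y ℤ.- + 1) ℤ.^ (length A ∸ r A))

IsFlowing : (G : Digraph) (k : ℕ) → (Fin (n G) → Fin k) → Set
IsFlowing G k c =
  All (λ e → c (proj₁ e) ≢ c (proj₂ e)) (E G) ×
  All (λ e → All (λ e' → proj₂ e ≡ proj₂ e' → c (proj₁ e) ≡ c (proj₁ e')) (E G)) (E G) ×
  All (λ e → All (λ e' → proj₁ e ≡ proj₁ e' → c (proj₂ e) ≡ c (proj₂ e')) (E G)) (E G)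

isFlowing? : (G : Digraph) (k : ℕ) (c : Fin (n G) → Fin k) → Dec (IsFlowing G k c)
isFlowing? G k c =
  all? (λ e → ¬? (c (proj₁ e) ≟ c (proj₂ e))) (E G) ×-dec
  all? (λ e → all? (λ e' → (proj₂ e ≟ proj₂ e') →-dec (c (proj₁ e) ≟ c (proj₁ e'))) (E G)) (E G) ×-dec
  all? (λ e → all? (λ e' → (proj₁ e ≟ proj₁ e') →-dec (c (proj₂ e) ≟ c (proj₂ e'))) (E G)) (E G)

-- all maps Fin m → Fin k, as vectors (each map exactly once)
allVecs : (k m : ℕ) → List (Vec (Fin k) m)
allVecs k zero    = [ Vec.[] ]
allVecs k (suc m) = concatMap (λ i → map (i Vec.∷_) (allVecs k m)) (Data.List.allFin k)

τ : (G : Digraph) → ℕ → ℕ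
τ G k = length (filter (λ v → isFlowing? G k (lookup v)) (allVecs k (n G)))

module Submission where

-- In an MP-tree call two edges in conflict when they share their head, share their tail, or form a
-- 2-cycle.  MP1, MP2 and the absence of undirected cycles make this an equivalence relation on the
-- edges, and the multipaths are exactly the edge sets meeting every class at most once.  So M_G is a
-- partition matroid whose rank r(A) counts the classes met by A, and
--   T(1 - k, 0) = (-1)^r(E) Σ_A (-1)^|A| k^(r(E) - r(A)) = (-1)^r(E) (k - 1)^r(E),
-- the alternating sum factorising over the classes.  On the other side, grow the tree from one vertex,
-- adding a vertex b next to a unique vertex a already present.  When the new edges open a new class,
-- a flowing colouring may give b any colour but that of a; when they join an existing class, the colour
-- of b is forced.  Hence τ_G(k) = k (k - 1)^r(E).

open import Defs
open import Data.Bool using (true; false)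
open import Data.Empty using (⊥; ⊥-elim)
open import Data.Fin using (Fin; zero; suc; _≟_; fromℕ<)
open import Data.Fin.Properties using (¬Fin0)
open import Data.Integer using (ℤ)
open import Data.List using (List; []; _∷_; _++_; [_]; length; map; filter; zip; allFin; concat)
open import Data.List.Properties
  using (map-++; map-∘; map-cong-local; ++-identityʳ; ++-assoc; filter-++; filter-all; length-++; length-tabulate)
open import Data.List.Membership.Propositional using (_∈_; _∉_; find; lose)
open import Data.List.Membership.Propositional.Properties
  using (∈-filter⁻; ∈-filter⁺; ∈-++⁻; ∈-++⁺ˡ; ∈-++⁺ʳ; ∈-map⁻; ∈-∃++; ∈-allFin)
import Data.List.Membership.DecPropositional as DecMembership
open import Data.List.Relation.Binary.Permutation.Propositional using (_↭_; ↭-sym)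
open import Data.List.Relation.Binary.Permutation.Propositional.Properties using (shift; ∈-resp-↭)
open import Data.List.Relation.Binary.Sublist.Propositional using (_⊆_; []; _∷_; _∷ʳ_; ⊆-refl)
open import Data.List.Relation.Binary.Sublist.Propositional.Properties
  using (All-resp-⊆; Any-resp-⊆; length-mono-≤; ++⁺; ++⁺ˡ)
open import Data.List.Relation.Binary.Subset.Propositional using () renaming (_⊆_ to _⊆ˢ_)
open import Data.List.Relation.Binary.Subset.Propositional.Properties using (filter-⊆; module ⊆-Reasoning)
open import Data.List.Relation.Unary.All as All using (All; []; _∷_; all?)
open import Data.List.Relation.Unary.Any using (Any; here; there; any?)
open import Data.List.Relation.Unary.Unique.Propositional using (Unique; []; _∷_)
import Data.List.Relation.Unary.Unique.Propositional.Properties as Unique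
open import Data.Nat as ℕ using (ℕ; zero; suc; _∸_; _≤_; z≤n; s≤s)
import Data.Nat.Properties as ℕ
open import Data.Nat.ListAction using (sum)
open import Data.Product using (_×_; _,_; proj₁; proj₂; ∃-syntax; uncurry) renaming (map to map-×)
open import Data.Product.Properties using (≡-dec)
open import Data.Sum using (_⊎_; inj₁; inj₂; [_,_]′)
open import Data.Unit using (⊤; tt)
open import Data.Vec using (Vec; lookup) renaming (_∷_ to _∷ᵥ_)
open import Function using (_∘_; id)
open import Level using (0ℓ)
open import Relation.Binary.Core using (Rel)
open import Relation.Binary.Definitions using (DecidableEquality; Reflexive; Symmetric)
open import Relation.Binary.PropositionalEquality
  using (_≡_; _≢_; refl; sym; trans; cong; cong₂; subst; module ≡-Reasoning)
open import Relation.Nullary using (¬_; Dec; yes; no; does; ¬?; contradiction)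
open import Relation.Nullary.Decidable using (_×-dec_; _⊎-dec_; _→-dec_; map′; decidable-stable)
open import Relation.Unary using (Pred; Decidable)

module _ {A : Set} where

  Unique-resp-⊆ : {xs ys : List A} → xs ⊆ ys → Unique ys → Unique xs
  Unique-resp-⊆ []         []       = []
  Unique-resp-⊆ (y ∷ʳ p)   (_ ∷ u)  = Unique-resp-⊆ p u
  Unique-resp-⊆ (refl ∷ p) (x∉ ∷ u) = All-resp-⊆ p x∉ ∷ Unique-resp-⊆ p u

  subsets-⊆ : ∀ (L : List A) {B} → B ∈ subsets L → B ⊆ L
  subsets-⊆ []      (here refl) = []
  subsets-⊆ (x ∷ L) B∈ with ∈-++⁻ (subsets L) B∈
  ... | inj₁ B∈L = x ∷ʳ subsets-⊆ L B∈L
  ... | inj₂ B∈xL with ∈-map⁻ (x ∷_) B∈xL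
  ...   | B , B∈L , refl = refl ∷ subsets-⊆ L B∈L

  pairs : List A → List (A × A)
  pairs []           = []
  pairs (x ∷ [])     = []
  pairs (x ∷ y ∷ zs) = (x , y) ∷ pairs (y ∷ zs)

  pairs-++ˡ : ∀ xs ys → pairs xs ⊆ˢ pairs (xs ++ ys)
  pairs-++ˡ (x ∷ y ∷ zs) ys (here p≡)  = here p≡
  pairs-++ˡ (x ∷ y ∷ zs) ys (there p∈) = there (pairs-++ˡ (y ∷ zs) ys p∈)

  pairs-++ʳ : ∀ xs ys → pairs ys ⊆ˢ pairs (xs ++ ys)
  pairs-++ʳ []           ys       p∈ = p∈
  pairs-++ʳ (x ∷ [])     (y ∷ ys) p∈ = there p∈
  pairs-++ʳ (x ∷ y ∷ xs) ys       p∈ = there (pairs-++ʳ (y ∷ xs) ys p∈)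

  zip-pairs : ∀ (v : A) vs w → zip (v ∷ vs) (vs ++ [ w ]) ≡ pairs (v ∷ vs ++ [ w ])
  zip-pairs v []       w = refl
  zip-pairs v (u ∷ vs) w = cong ((v , u) ∷_) (zip-pairs u vs w)

  unique⊎duplicate : DecidableEquality A → ∀ vs →
                     Unique vs ⊎ ∃[ p ] ∃[ x ] ∃[ q ] ∃[ s ] (vs ≡ p ++ x ∷ q ++ x ∷ s)
  unique⊎duplicate _≟_ []       = inj₁ []
  unique⊎duplicate _≟_ (y ∷ ys) with any? (y ≟_) ys | unique⊎duplicate _≟_ ys
  ... | yes y∈ | _ with q , s , refl ← ∈-∃++ y∈ = inj₂ ([] , y , q , s , refl)
  ... | no y∉  | inj₁ u                         = inj₁ (All.tabulate (λ { z∈ refl → y∉ z∈ }) ∷ u)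
  ... | no _   | inj₂ (p , x , q , s , refl)    = inj₂ (y ∷ p , x , q , s , refl)

  length-between : ∀ (p : List A) x q s → suc (length (x ∷ q)) ≤ length (p ++ x ∷ q ++ x ∷ s)
  length-between []      x q s = s≤s (shorter q)
    where
    shorter : ∀ q → suc (length q) ≤ length (q ++ x ∷ s)
    shorter []      = s≤s z≤n
    shorter (y ∷ q) = s≤s (shorter q)
  length-between (y ∷ p) x q s = ℕ.m≤n⇒m≤1+n (length-between p x q s)

module _ {n : ℕ} where

  cycleEdges-pairs : ∀ (v : Fin n) vs → cycleEdges (v ∷ vs) ≡ pairs (v ∷ vs ++ [ v ])
  cycleEdges-pairs v vs = zip-pairs v vs v

  -- Between two occurrences of a repeated vertex lies a shorter closed walk.
  simple-cycle : ∀ (S : List (Edge n)) v vs → cycleEdges (v ∷ vs) ⊆ˢ S →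
                 ∃[ u ] ∃[ us ] (Unique (u ∷ us) × cycleEdges (u ∷ us) ⊆ˢ S)
  simple-cycle S v vs = go (length (v ∷ vs)) v vs ℕ.≤-refl
    where
    go : ∀ fuel v vs → length (v ∷ vs) ≤ fuel → cycleEdges (v ∷ vs) ⊆ˢ S →
         ∃[ u ] ∃[ us ] (Unique (u ∷ us) × cycleEdges (u ∷ us) ⊆ˢ S)
    go fuel v vs len cyc⊆S with unique⊎duplicate _≟_ (v ∷ vs)
    ... | inj₁ u = v , vs , u , cyc⊆S
    go zero    v vs () cyc⊆S | inj₂ _
    go (suc f) v vs len cyc⊆S | inj₂ (p , x , q , s , eq) =
      go f x q (ℕ.≤-pred (ℕ.≤-trans (length-between p x q s) (subst (_≤ suc f) (cong length eq) len))) inner⊆S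
      where
      inner⊆S : cycleEdges (x ∷ q) ⊆ˢ S
      inner⊆S = begin
        cycleEdges (x ∷ q)             ≡⟨ cycleEdges-pairs x q ⟩
        pairs (x ∷ q ++ [ x ])         ⊆⟨ pairs-++ˡ (x ∷ q ++ [ x ]) s ⟩
        pairs (x ∷ (q ++ [ x ]) ++ s)  ≡⟨ cong (pairs ∘ (x ∷_)) (++-assoc q [ x ] s) ⟩
        pairs (x ∷ q ++ x ∷ s)         ⊆⟨ pairs-++ʳ p (x ∷ q ++ x ∷ s) ⟩
        pairs (p ++ x ∷ q ++ x ∷ s)    ≡⟨ cong pairs eq ⟨
        pairs (v ∷ vs)                 ⊆⟨ pairs-++ˡ (v ∷ vs) [ v ] ⟩
        pairs (v ∷ vs ++ [ v ])        ≡⟨ cycleEdges-pairs v vs ⟨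
        cycleEdges (v ∷ vs)            ⊆⟨ cyc⊆S ⟩
        S                              ∎
        where
        open ⊆-Reasoning (Edge n)

module _ where
  open import Data.Integer using (+_; -_; _+_; _-_; _*_; _^_)
  import Data.Integer.Properties as ℤ
  open import Data.Integer.Solver using (module +-*-Solver)
  open +-*-Solver
  open ≡-Reasoning

  sumℤ-++ : ∀ xs ys → sumℤ (xs ++ ys) ≡ sumℤ xs + sumℤ ys
  sumℤ-++ []       ys = sym (ℤ.+-identityˡ _)
  sumℤ-++ (x ∷ xs) ys = trans (cong (_+_ x) (sumℤ-++ xs ys)) (sym (ℤ.+-assoc x _ _))

  sumℤ-*ˡ : ∀ c xs → sumℤ (map (c *_) xs) ≡ c * sumℤ xs
  sumℤ-*ˡ c []       = sym (ℤ.*-zeroʳ c)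
  sumℤ-*ˡ c (x ∷ xs) = trans (cong (_+_ (c * x)) (sumℤ-*ˡ c xs)) (sym (ℤ.*-distribˡ-+ c x _))

  sumℤ-neg : ∀ xs → sumℤ (map -_ xs) ≡ - sumℤ xs
  sumℤ-neg xs = begin
    sumℤ (map -_ xs)            ≡⟨ cong sumℤ (map-cong-local (All.tabulate {xs = xs} (sym ∘ ℤ.-1*i≡-i ∘ _))) ⟩
    sumℤ (map (- + 1 *_) xs)    ≡⟨ sumℤ-*ˡ (- + 1) xs ⟩
    - + 1 * sumℤ xs             ≡⟨ ℤ.-1*i≡-i _ ⟩
    - sumℤ xs                   ∎

  pos-^ : ∀ a m → + (a ℕ.^ m) ≡ (+ a) ^ m
  pos-^ a zero    = refl
  pos-^ a (suc m) = trans (ℤ.pos-* a (a ℕ.^ m)) (cong (+ a *_) (pos-^ a m))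

  sign : ℕ → ℤ
  sign n = (- + 1) ^ n

  sign-square : ∀ n → sign n * sign n ≡ + 1
  sign-square zero    = refl
  sign-square (suc n) = trans (solve 1 (λ s → (con (- + 1) :* s) :* (con (- + 1) :* s) := s :* s) refl (sign n))
                              (sign-square n)

  neg-^ : ∀ i n → (- i) ^ n ≡ sign n * i ^ n
  neg-^ i zero    = refl
  neg-^ i (suc n) = begin
    - i * (- i) ^ n                  ≡⟨ cong₂ _*_ (sym (ℤ.-1*i≡-i i)) (neg-^ i n) ⟩
    (- + 1 * i) * (sign n * i ^ n)   ≡⟨ solve 4 (λ m i s p → (m :* i) :* (s :* p) := (m :* s) :* (i :* p))
                                              refl (- + 1) i (sign n) (i ^ n) ⟩
    sign (suc n) * i ^ suc n         ∎

  -- The summand of T(1 - k, 0) for a set of size b and rank c in a matroid of rank a.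
  tutte-summand : ∀ k {a b c} → c ≤ a → c ≤ b →
                  ((+ 1 - + k) - + 1) ^ (a ∸ c) * (+ 0 - + 1) ^ (b ∸ c) ≡ sign a * (sign b * (+ k) ^ (a ∸ c))
  tutte-summand k {a} {b} {c} c≤a c≤b = begin
    ((+ 1 - + k) - + 1) ^ (a ∸ c) * (+ 0 - + 1) ^ (b ∸ c)
      ≡⟨ cong (λ i → i ^ (a ∸ c) * sign (b ∸ c)) (solve 1 (λ k → con (+ 1) :- k :- con (+ 1) := :- k) refl (+ k)) ⟩
    (- + k) ^ (a ∸ c) * sign (b ∸ c)
      ≡⟨ cong (_* sign (b ∸ c)) (neg-^ (+ k) (a ∸ c)) ⟩
    sign (a ∸ c) * K * sign (b ∸ c)
      ≡⟨ trans (cong (sign (a ∸ c) * K * sign (b ∸ c) *_) (sign-square c)) (ℤ.*-identityʳ _) ⟨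
    sign (a ∸ c) * K * sign (b ∸ c) * (sign c * sign c)
      ≡⟨ solve 4 (λ sa K sb sc → sa :* K :* sb :* (sc :* sc) := sa :* sc :* (sb :* sc :* K))
                 refl (sign (a ∸ c)) K (sign (b ∸ c)) (sign c) ⟩
    sign (a ∸ c) * sign c * (sign (b ∸ c) * sign c * K)
      ≡⟨ cong₂ (λ x y → x * (y * K)) (sign-+ (a ∸ c) c) (sign-+ (b ∸ c) c) ⟨
    sign (a ∸ c ℕ.+ c) * (sign (b ∸ c ℕ.+ c) * K)
      ≡⟨ cong₂ (λ x y → sign x * (sign y * K)) (ℕ.m∸n+n≡m c≤a) (ℕ.m∸n+n≡m c≤b) ⟩
    sign a * (sign b * K)
      ∎
    where
    K : ℤ
    K = (+ k) ^ (a ∸ c)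
    sign-+ : ∀ m n → sign (m ℕ.+ n) ≡ sign m * sign n
    sign-+ = ℤ.^-distribˡ-+-* (- + 1)

-- Partition matroids

module PartitionMatroid {A : Set} (_≟_ : DecidableEquality A)
  {_~_ : Rel A 0ℓ} (_~?_ : ∀ x y → Dec (x ~ y)) (~-refl : Reflexive _~_) (~-sym : Symmetric _~_)
  (E : List A) (~-trans : ∀ {x y z} → x ∈ E → y ∈ E → z ∈ E → x ~ y → y ~ z → x ~ z) where

  open DecMembership _≟_ using (_∈?_)

  Related : A → List A → Set
  Related x = Any (x ~_)

  related? : ∀ x L → Dec (Related x L)
  related? x = any? (x ~?_)

  representatives : List A → List A
  representatives []      = []
  representatives (x ∷ L) with related? x L
  ... | yes _ = representatives L
  ... | no  _ = x ∷ representatives L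

  -- ρ L is the number of ~-classes met by L: its rank in the partition matroid on E.
  ρ : List A → ℕ
  ρ = length ∘ representatives

  ρ-∷-related : ∀ {x L} → Related x L → ρ (x ∷ L) ≡ ρ L
  ρ-∷-related {x} {L} r with related? x L
  ... | yes _ = refl
  ... | no ¬r = contradiction r ¬r

  ρ-∷-unrelated : ∀ {x L} → ¬ Related x L → ρ (x ∷ L) ≡ suc (ρ L)
  ρ-∷-unrelated {x} {L} ¬r with related? x L
  ... | yes r = contradiction r ¬r
  ... | no _  = refl

  representatives-⊆ : ∀ L → representatives L ⊆ L
  representatives-⊆ []      = []
  representatives-⊆ (x ∷ L) with related? x L
  ... | yes _ = x ∷ʳ representatives-⊆ L
  ... | no  _ = refl ∷ representatives-⊆ L

  ρ≤length : ∀ L → ρ L ≤ length L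
  ρ≤length L = length-mono-≤ (representatives-⊆ L)

  Independent : List A → Set
  Independent B = ∀ {x y} → x ∈ B → y ∈ B → x ~ y → x ≡ y

  independent-⊆ : ∀ {B B′} → B′ ⊆ˢ B → Independent B → Independent B′
  independent-⊆ B′⊆B indep x∈ y∈ = indep (B′⊆B x∈) (B′⊆B y∈)

  representatives-independent : ∀ L → Independent (representatives L)
  representatives-independent []      ()
  representatives-independent (x ∷ L) with related? x L
  ... | yes _ = representatives-independent L
  ... | no ¬r = independent
    where
    related : ∀ {y} → y ∈ representatives L → x ~ y → Related x L
    related y∈ = lose (Any-resp-⊆ (representatives-⊆ L) y∈)
    independent : Independent (x ∷ representatives L)
    independent (here refl) (here refl) _   = refl
    independent (here refl) (there y∈)  x~y = contradiction (related y∈ x~y) ¬r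
    independent (there y∈)  (here refl) y~x = contradiction (related y∈ (~-sym y~x)) ¬r
    independent (there y∈)  (there z∈)  y~z = representatives-independent L y∈ z∈ y~z

  representatives-unique : ∀ L → Unique (representatives L)
  representatives-unique []      = []
  representatives-unique (x ∷ L) with related? x L
  ... | yes _ = representatives-unique L
  ... | no ¬r = All.tabulate (λ { y∈ refl → ¬r (lose (Any-resp-⊆ (representatives-⊆ L) y∈) ~-refl) })
              ∷ representatives-unique L

  private
    _∖_ : List A → A → List A
    B ∖ x = filter (λ z → ¬? (z ≟ x)) B

    length-∖ : ∀ B x → Unique B → length B ≤ suc (length (B ∖ x))
    length-∖ []      x _ = z≤n
    length-∖ (z ∷ B) x (z∉B ∷ uniq) with z ≟ x
    ... | yes refl = ℕ.≤-reflexive (cong (suc ∘ length) (sym (filter-all (λ w → ¬? (w ≟ z)) z≢B)))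
      where
      z≢B : All (_≢ z) B
      z≢B = All.map (_∘ sym) z∉B
    ... | no  _    = s≤s (length-∖ B x uniq)

    ∖-⊆ˢ : ∀ B x → B ∖ x ⊆ˢ B
    ∖-⊆ˢ B x = filter-⊆ (λ w → ¬? (w ≟ x)) B

    ∈-∖⁻ : ∀ B {x z} → z ∈ B ∖ x → z ≢ x
    ∈-∖⁻ B {x} z∈ = proj₂ (∈-filter⁻ (λ w → ¬? (w ≟ x)) {xs = B} z∈)

    ∈-∖⁺ : ∀ {B x z} → z ∈ B → z ≢ x → z ∈ B ∖ x
    ∈-∖⁺ {x = x} = ∈-filter⁺ (λ w → ¬? (w ≟ x))

    ∖-⊆ˢ-∷ : ∀ {B L x} → B ⊆ˢ x ∷ L → B ∖ x ⊆ˢ L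
    ∖-⊆ˢ-∷ {B} {x = x} B⊆ z∈ with B⊆ (∖-⊆ˢ B x z∈)
    ... | here z≡x  = contradiction z≡x (∈-∖⁻ B z∈)
    ... | there z∈L = z∈L

  -- Induction on L: when the head x of L is related to a later y, the element x of B is exchanged for y.
  independent-length≤ρ : ∀ L → L ⊆ˢ E → ∀ {B} → Unique B → Independent B → B ⊆ˢ L → length B ≤ ρ L
  independent-length≤ρ []      _   {[]}    _ _ _  = z≤n
  independent-length≤ρ []      _   {_ ∷ _} _ _ B⊆ with () ← B⊆ (here refl)
  independent-length≤ρ (x ∷ L) L⊆E {B} uniq indep B⊆ with related? x L
  ... | no _ = ℕ.≤-trans (length-∖ B x uniq) (s≤s (independent-length≤ρ L (L⊆E ∘ there)
                 (Unique.filter⁺ _ uniq) (independent-⊆ (∖-⊆ˢ B x) indep) (∖-⊆ˢ-∷ B⊆)))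
  ... | yes r with find r | x ∈? B
  ...   | y , y∈L , x~y | no x∉B =
          independent-length≤ρ L (L⊆E ∘ there) uniq indep (λ z∈ → ∖-⊆ˢ-∷ B⊆ (∈-∖⁺ z∈ λ { refl → x∉B z∈ }))
  ...   | y , y∈L , x~y | yes x∈B =
          ℕ.≤-trans (length-∖ B x uniq) (independent-length≤ρ L (L⊆E ∘ there) uniq′ indep′ B′⊆L)
    where
    B′ : List A
    B′ = y ∷ B ∖ x
    y≁ : ∀ {z} → z ∈ B ∖ x → ¬ y ~ z
    y≁ {z} z∈ y~z = ∈-∖⁻ B z∈ (sym (indep x∈B z∈B x~z))
      where
      z∈B : z ∈ B
      z∈B = ∖-⊆ˢ B x z∈
      x~z : x ~ z
      x~z = ~-trans (L⊆E (B⊆ x∈B)) (L⊆E (there y∈L)) (L⊆E (B⊆ z∈B)) x~y y~z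
    uniq′ : Unique B′
    uniq′ = All.tabulate (λ { z∈ refl → y≁ z∈ ~-refl }) ∷ Unique.filter⁺ _ uniq
    indep′ : Independent B′
    indep′ (here refl) (here refl) _   = refl
    indep′ (here refl) (there z∈)  y~z = contradiction y~z (y≁ z∈)
    indep′ (there z∈)  (here refl) z~y = contradiction (~-sym z~y) (y≁ z∈)
    indep′ (there z∈)  (there w∈)  z~w = indep (∖-⊆ˢ B x z∈) (∖-⊆ˢ B x w∈) z~w
    B′⊆L : B′ ⊆ˢ L
    B′⊆L (here refl) = y∈L
    B′⊆L (there z∈)  = ∖-⊆ˢ-∷ B⊆ z∈

  ρ-mono : ∀ {X Y} → Y ⊆ˢ E → X ⊆ˢ Y → ρ X ≤ ρ Y
  ρ-mono {X} {Y} Y⊆E X⊆Y = independent-length≤ρ Y Y⊆E (representatives-unique X)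
    (representatives-independent X) (X⊆Y ∘ Any-resp-⊆ (representatives-⊆ X))

  ρ-cong : ∀ {X Y} → X ⊆ˢ E → Y ⊆ˢ E → X ⊆ˢ Y → Y ⊆ˢ X → ρ X ≡ ρ Y
  ρ-cong X⊆E Y⊆E X⊆Y Y⊆X = ℕ.≤-antisym (ρ-mono Y⊆E X⊆Y) (ρ-mono X⊆E Y⊆X)

  ρ-shift : ∀ x L H → x ∷ L ++ H ⊆ˢ E → ρ (L ++ x ∷ H) ≡ ρ (x ∷ L ++ H)
  ρ-shift x L H ⊆E = ρ-cong (⊆E ∘ ∈-resp-↭ shifted) ⊆E (∈-resp-↭ shifted) (∈-resp-↭ (↭-sym shifted))
    where
    shifted : L ++ x ∷ H ↭ x ∷ L ++ H
    shifted = shift x L H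

  ρ-absorb : ∀ x L H → x ∷ L ++ H ⊆ˢ E → Related x H → ρ (L ++ x ∷ H) ≡ ρ (L ++ H)
  ρ-absorb x L H ⊆E r = trans (ρ-shift x L H ⊆E) (ρ-∷-related (Any-resp-⊆ (++⁺ˡ L ⊆-refl) r))

  -- An element of
  -- L related to the rest of L ∪ H is moved into H; this is how a class with several elements is summed.
  module SignedSum (t : ℤ) where
    open import Data.Integer using (+_; -_; _+_; _-_; _*_; _^_)
    import Data.Integer.Properties as ℤ
    open import Data.Integer.Solver using (module +-*-Solver)
    open ≡-Reasoning

    term : List A → List A → List A → ℤ
    term L H B = sign (length B) * t ^ (ρ (L ++ H) ∸ ρ (B ++ H))

    signedSum : List A → List A → ℤ
    signedSum L H = sumℤ (map (term L H) (subsets L))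

    private
      sum-cong : ∀ L (f g : List A → ℤ) → (∀ {B} → B ⊆ L → f B ≡ g B) →
                 sumℤ (map f (subsets L)) ≡ sumℤ (map g (subsets L))
      sum-cong L f g f≗g = cong sumℤ (map-cong-local (All.tabulate (f≗g ∘ subsets-⊆ L)))

      negated-sum : ∀ L (f g : List A → ℤ) → (∀ {B} → B ⊆ L → f B ≡ - g B) →
                    sumℤ (map f (subsets L)) ≡ - sumℤ (map g (subsets L))
      negated-sum L f g f≗-g = begin
        sumℤ (map f (subsets L))          ≡⟨ sum-cong L f (-_ ∘ g) f≗-g ⟩
        sumℤ (map (-_ ∘ g) (subsets L))   ≡⟨ cong sumℤ (map-∘ (subsets L)) ⟩
        sumℤ (map -_ (map g (subsets L))) ≡⟨ sumℤ-neg (map g (subsets L)) ⟩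
        - sumℤ (map g (subsets L))        ∎

      ++-⊆ˢ : ∀ {B L : List A} H → B ⊆ L → B ++ H ⊆ˢ L ++ H
      ++-⊆ˢ H B⊆L = Any-resp-⊆ (++⁺ B⊆L (⊆-refl {x = H}))

      ∈-tail : ∀ {x x₀ y₀ L H} → ¬ Related x H → x₀ ∈ x ∷ L → y₀ ∈ H → x₀ ~ y₀ → x₀ ∈ L
      ∈-tail ¬rH (here refl)  y₀∈ x₀~y₀ = contradiction (lose y₀∈ x₀~y₀) ¬rH
      ∈-tail _   (there x₀∈L) _   _     = x₀∈L

      term-cong : ∀ L H L′ H′ B → ρ (L ++ H) ≡ ρ (L′ ++ H′) → ρ (B ++ H) ≡ ρ (B ++ H′) →
                  term L H B ≡ term L′ H′ B
      term-cong _ _ _ _ B eqL eqB = cong₂ (λ a b → sign (length B) * t ^ (a ∸ b)) eqL eqB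

      term-head : ∀ x L H B {a b} → ρ (x ∷ L ++ H) ≡ a → ρ (x ∷ B ++ H) ≡ b →
                  term (x ∷ L) H (x ∷ B) ≡ - (sign (length B) * t ^ (a ∸ b))
      term-head x L H B refl refl = trans (ℤ.*-assoc (- + 1) (sign (length B)) _) (ℤ.-1*i≡-i _)

      signedSum-split : ∀ x L H → signedSum (x ∷ L) H ≡
        sumℤ (map (term (x ∷ L) H) (subsets L)) + sumℤ (map (term (x ∷ L) H ∘ (x ∷_)) (subsets L))
      signedSum-split x L H = begin
        sumℤ (map (term (x ∷ L) H) (subsets L ++ map (x ∷_) (subsets L)))
          ≡⟨ cong sumℤ (map-++ (term (x ∷ L) H) (subsets L) _) ⟩
        sumℤ (map (term (x ∷ L) H) (subsets L) ++ map (term (x ∷ L) H) (map (x ∷_) (subsets L)))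
          ≡⟨ sumℤ-++ (map (term (x ∷ L) H) (subsets L)) _ ⟩
        sumℤ (map (term (x ∷ L) H) (subsets L)) + sumℤ (map (term (x ∷ L) H) (map (x ∷_) (subsets L)))
          ≡⟨ cong (λ l → sumℤ (map (term (x ∷ L) H) (subsets L)) + sumℤ l) (map-∘ (subsets L)) ⟨
        sumℤ (map (term (x ∷ L) H) (subsets L)) + sumℤ (map (term (x ∷ L) H ∘ (x ∷_)) (subsets L))
          ∎

    signedSum-∷-related : ∀ x L H → x ∷ L ++ H ⊆ˢ E → Related x (L ++ H) →
                          signedSum (x ∷ L) H ≡ signedSum L H - signedSum L (x ∷ H)
    signedSum-∷-related x L H ⊆E r = trans (signedSum-split x L H) (cong₂ _+_
      (sum-cong L (term (x ∷ L) H) (term L H) (λ {B} _ → term-cong (x ∷ L) H L H B (ρ-∷-related r) refl))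
      (negated-sum L _ (term L (x ∷ H)) (λ {B} B⊆L →
        term-head x L H B (sym (ρ-shift x L H ⊆E)) (sym (ρ-shift x B H (⊆E ∘ ++-⊆ˢ H (refl ∷ B⊆L)))))))

    signedSum-∷-unrelated : ∀ x L H → x ∷ L ++ H ⊆ˢ E → ¬ Related x (L ++ H) →
                            signedSum (x ∷ L) H ≡ (t - + 1) * signedSum L H
    signedSum-∷-unrelated x L H ⊆E ¬r = trans (signedSum-split x L H) (trans (cong₂ _+_
      (trans (sum-cong L _ ((t *_) ∘ term L H) (λ {B} B⊆L → grow B (ρ-mono (⊆E ∘ there) (++-⊆ˢ H B⊆L))))
             (trans (cong sumℤ (map-∘ (subsets L))) (sumℤ-*ˡ t (map (term L H) (subsets L)))))
      (negated-sum L _ (term L H) (λ {B} B⊆L →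
        term-head x L H B (ρ-∷-unrelated ¬r) (ρ-∷-unrelated (¬r ∘ Any-resp-⊆ (++⁺ B⊆L ⊆-refl))))))
      (solve 2 (λ t s → t :* s :+ :- s := (t :- con (+ 1)) :* s) refl t (signedSum L H)))
      where
      open +-*-Solver
      grow : ∀ B → ρ (B ++ H) ≤ ρ (L ++ H) → term (x ∷ L) H B ≡ t * term L H B
      grow B le = begin
        sign (length B) * t ^ (ρ (x ∷ L ++ H) ∸ ρ (B ++ H))
          ≡⟨ cong (λ a → sign (length B) * t ^ (a ∸ ρ (B ++ H))) (ρ-∷-unrelated ¬r) ⟩
        sign (length B) * t ^ (suc (ρ (L ++ H)) ∸ ρ (B ++ H))
          ≡⟨ cong (λ n → sign (length B) * t ^ n) (ℕ.+-∸-assoc 1 le) ⟩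
        sign (length B) * (t * t ^ (ρ (L ++ H) ∸ ρ (B ++ H)))
          ≡⟨ solve 3 (λ s t p → s :* (t :* p) := t :* (s :* p)) refl (sign (length B)) t
                   (t ^ (ρ (L ++ H) ∸ ρ (B ++ H))) ⟩
        t * term L H B
          ∎

    signedSum-absorb : ∀ x L H → x ∷ L ++ H ⊆ˢ E → Related x H → signedSum L (x ∷ H) ≡ signedSum L H
    signedSum-absorb x L H ⊆E r = sum-cong L (term L (x ∷ H)) (term L H) (λ {B} B⊆L →
      term-cong L (x ∷ H) L H B (ρ-absorb x L H ⊆E r) (ρ-absorb x B H (⊆E ∘ ++-⊆ˢ H (refl ∷ B⊆L)) r))

    signedSum-vanishes : ∀ L H → L ++ H ⊆ˢ E → ∀ {x y} → x ∈ L → y ∈ H → x ~ y → signedSum L H ≡ + 0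
    signedSum-vanishes (x ∷ L) H ⊆E {x₀} {y₀} x₀∈ y₀∈ x₀~y₀ = cases (related? x (L ++ H)) (related? x H)
      where
      cases : Dec (Related x (L ++ H)) → Dec (Related x H) → signedSum (x ∷ L) H ≡ + 0
      cases (no ¬r) _ = begin
        signedSum (x ∷ L) H          ≡⟨ signedSum-∷-unrelated x L H ⊆E ¬r ⟩
        (t - + 1) * signedSum L H    ≡⟨ cong ((t - + 1) *_) (signedSum-vanishes L H (⊆E ∘ there)
                                          (∈-tail (¬r ∘ Any-resp-⊆ (++⁺ˡ L ⊆-refl)) x₀∈ y₀∈ x₀~y₀) y₀∈ x₀~y₀) ⟩
        (t - + 1) * + 0              ≡⟨ ℤ.*-zeroʳ (t - + 1) ⟩
        + 0                          ∎
      cases (yes r) (yes rH) = begin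
        signedSum (x ∷ L) H                   ≡⟨ signedSum-∷-related x L H ⊆E r ⟩
        signedSum L H - signedSum L (x ∷ H)   ≡⟨ cong (_-_ (signedSum L H)) (signedSum-absorb x L H ⊆E rH) ⟩
        signedSum L H - signedSum L H         ≡⟨ ℤ.+-inverseʳ (signedSum L H) ⟩
        + 0                                   ∎
      cases (yes r) (no ¬rH) with find r
      ... | y , y∈ , x~y with ∈-++⁻ L y∈
      ...   | inj₂ y∈H = contradiction (lose y∈H x~y) ¬rH
      ...   | inj₁ y∈L = begin
        signedSum (x ∷ L) H
          ≡⟨ signedSum-∷-related x L H ⊆E r ⟩
        signedSum L H - signedSum L (x ∷ H)
          ≡⟨ cong₂ _-_ (signedSum-vanishes L H (⊆E ∘ there) (∈-tail ¬rH x₀∈ y₀∈ x₀~y₀) y₀∈ x₀~y₀)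
                       (signedSum-vanishes L (x ∷ H) (⊆E ∘ ∈-resp-↭ (shift x L H))
                                           y∈L (here refl) (~-sym x~y)) ⟩
        + 0 - + 0
          ∎

    signedSum-separated : ∀ L H → L ++ H ⊆ˢ E → (∀ {x y} → x ∈ L → y ∈ H → ¬ x ~ y) →
                          signedSum L H ≡ (t - + 1) ^ (ρ (L ++ H) ∸ ρ H)
    signedSum-separated []      H _  _ rewrite ℕ.n∸n≡0 (ρ H) = refl
    signedSum-separated (x ∷ L) H ⊆E sep = cases (related? x (L ++ H))
      where
      IH : signedSum L H ≡ (t - + 1) ^ (ρ (L ++ H) ∸ ρ H)
      IH = signedSum-separated L H (⊆E ∘ there) (sep ∘ there)
      cases : Dec (Related x (L ++ H)) → signedSum (x ∷ L) H ≡ (t - + 1) ^ (ρ (x ∷ L ++ H) ∸ ρ H)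
      cases (yes r) with find r
      ... | y , y∈ , x~y with ∈-++⁻ L y∈
      ...   | inj₂ y∈H = contradiction x~y (sep (here refl) y∈H)
      ...   | inj₁ y∈L = begin
        signedSum (x ∷ L) H
          ≡⟨ signedSum-∷-related x L H ⊆E r ⟩
        signedSum L H - signedSum L (x ∷ H)
          ≡⟨ cong₂ _-_ IH (signedSum-vanishes L (x ∷ H) (⊆E ∘ ∈-resp-↭ (shift x L H))
                                              y∈L (here refl) (~-sym x~y)) ⟩
        (t - + 1) ^ (ρ (L ++ H) ∸ ρ H) - + 0
          ≡⟨ ℤ.+-identityʳ _ ⟩
        (t - + 1) ^ (ρ (L ++ H) ∸ ρ H)
          ≡⟨ cong (λ a → (t - + 1) ^ (a ∸ ρ H)) (ρ-∷-related r) ⟨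
        (t - + 1) ^ (ρ (x ∷ L ++ H) ∸ ρ H)
          ∎
      cases (no ¬r) = begin
        signedSum (x ∷ L) H
          ≡⟨ signedSum-∷-unrelated x L H ⊆E ¬r ⟩
        (t - + 1) * signedSum L H
          ≡⟨ cong ((t - + 1) *_) IH ⟩
        (t - + 1) ^ suc (ρ (L ++ H) ∸ ρ H)
          ≡⟨ cong ((t - + 1) ^_) (ℕ.+-∸-assoc 1 (ρ-mono (⊆E ∘ there) (∈-++⁺ʳ L))) ⟨
        (t - + 1) ^ (suc (ρ (L ++ H)) ∸ ρ H)
          ≡⟨ cong (λ a → (t - + 1) ^ (a ∸ ρ H)) (ρ-∷-unrelated ¬r) ⟨
        (t - + 1) ^ (ρ (x ∷ L ++ H) ∸ ρ H)
          ∎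

    signedSum-ground : signedSum E [] ≡ (t - + 1) ^ ρ E
    signedSum-ground = trans (signedSum-separated E [] (λ {z} → subst (z ∈_) (++-identityʳ E)) (λ _ ()))
                             (cong (λ L → (t - + 1) ^ ρ L) (++-identityʳ E))

-- Counting

module _ where
  open import Data.Nat using (_+_; _*_; _^_)
  open import Data.Nat.Solver using (module +-*-Solver)
  open import Algebra.Properties.CommutativeSemigroup ℕ.+-commutativeSemigroup
    using () renaming (interchange to +-interchange)

  count : ∀ {A : Set} {P : Pred A 0ℓ} → Decidable P → List A → ℕ
  count P? = length ∘ filter P?

  module _ {A : Set} where

    count-cong : ∀ {P Q : Pred A 0ℓ} (P? : Decidable P) (Q? : Decidable Q) xs →
                 (∀ {x} → x ∈ xs → P x → Q x) → (∀ {x} → x ∈ xs → Q x → P x) → count P? xs ≡ count Q? xs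
    count-cong P? Q? []       _   _   = refl
    count-cong P? Q? (x ∷ xs) P⇒Q Q⇒P with P? x | Q? x
    ... | yes _ | yes _ = cong suc (count-cong P? Q? xs (P⇒Q ∘ there) (Q⇒P ∘ there))
    ... | no _  | no _  = count-cong P? Q? xs (P⇒Q ∘ there) (Q⇒P ∘ there)
    ... | yes p | no ¬q = contradiction (P⇒Q (here refl) p) ¬q
    ... | no ¬p | yes q = contradiction (Q⇒P (here refl) q) ¬p

    count-concat : ∀ {P : Pred A 0ℓ} (P? : Decidable P) xss → count P? (concat xss) ≡ sum (map (count P?) xss)
    count-concat P? []         = refl
    count-concat P? (xs ∷ xss) = begin
      length (filter P? (xs ++ concat xss))            ≡⟨ cong length (filter-++ P? xs (concat xss)) ⟩
      length (filter P? xs ++ filter P? (concat xss))  ≡⟨ length-++ (filter P? xs) ⟩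
      count P? xs + count P? (concat xss)              ≡⟨ cong (count P? xs +_) (count-concat P? xss) ⟩
      count P? xs + sum (map (count P?) xss)           ∎
      where
      open ≡-Reasoning

    count-map : ∀ {B : Set} {P : Pred B 0ℓ} (P? : Decidable P) (f : A → B) xs →
                count P? (map f xs) ≡ count (λ x → P? (f x)) xs
    count-map P? f []       = refl
    count-map P? f (x ∷ xs) with does (P? (f x))
    ... | true  = cong suc (count-map P? f xs)
    ... | false = count-map P? f xs

    count-all : ∀ {P : Pred A 0ℓ} (P? : Decidable P) xs → (∀ {x} → x ∈ xs → P x) → count P? xs ≡ length xs
    count-all P? []       _   = refl
    count-all P? (x ∷ xs) all with P? x
    ... | yes _  = cong suc (count-all P? xs (all ∘ there))
    ... | no ¬px = contradiction (all (here refl)) ¬px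

    count-complement : ∀ {P : Pred A 0ℓ} (P? : Decidable P) xs → count P? xs + count (¬? ∘ P?) xs ≡ length xs
    count-complement P? []       = refl
    count-complement P? (x ∷ xs) with does (P? x)
    ... | true  = cong suc (count-complement P? xs)
    ... | false = trans (ℕ.+-suc _ _) (cong suc (count-complement P? xs))

    count-split : ∀ {P Q : Pred A 0ℓ} (P? : Decidable P) (Q? : Decidable Q) xs →
                  count P? xs ≡ count (λ x → P? x ×-dec Q? x) xs + count (λ x → P? x ×-dec ¬? (Q? x)) xs
    count-split P? Q? []       = refl
    count-split P? Q? (x ∷ xs) with does (P? x) | does (Q? x)
    ... | true  | true  = cong suc (count-split P? Q? xs)
    ... | true  | false = trans (cong suc (count-split P? Q? xs)) (sym (ℕ.+-suc _ _))
    ... | false | _     = count-split P? Q? xs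

    count-∷ : ∀ {P : Pred A 0ℓ} (P? : Decidable P) x xs → count P? (x ∷ xs) ≡ count P? [ x ] + count P? xs
    count-∷ P? x xs with does (P? x)
    ... | true  = refl
    ... | false = refl

    count-none : ∀ {P : Pred A 0ℓ} (P? : Decidable P) xs → (∀ {x} → x ∈ xs → ¬ P x) → count P? xs ≡ 0
    count-none P? []       _    = refl
    count-none P? (x ∷ xs) none with P? x
    ... | yes px = contradiction px (none (here refl))
    ... | no _   = count-none P? xs (none ∘ there)

    count≡0⇒¬ : ∀ {P : Pred A 0ℓ} (P? : Decidable P) xs {x} → count P? xs ≡ 0 → x ∈ xs → ¬ P x
    count≡0⇒¬ P? (y ∷ xs) eq x∈ with P? y
    count≡0⇒¬ P? (y ∷ xs) eq (here refl) | no ¬py = ¬py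
    count≡0⇒¬ P? (y ∷ xs) eq (there x∈)  | no _   = count≡0⇒¬ P? xs eq x∈

    count≡suc⇒∃ : ∀ {P : Pred A 0ℓ} (P? : Decidable P) xs {o} → count P? xs ≡ suc o → ∃[ x ] (x ∈ xs × P x)
    count≡suc⇒∃ P? (y ∷ xs) eq with P? y
    ... | yes py = y , here refl , py
    ... | no _ with x , x∈ , px ← count≡suc⇒∃ P? xs eq = x , there x∈ , px

  module _ {A : Set} where

    sum-cong : ∀ (f g : A → ℕ) xs → (∀ {x} → x ∈ xs → f x ≡ g x) → sum (map f xs) ≡ sum (map g xs)
    sum-cong f g []       _   = refl
    sum-cong f g (x ∷ xs) f≗g = cong₂ _+_ (f≗g (here refl)) (sum-cong f g xs (f≗g ∘ there))

    sum-*ˡ : ∀ c (f : A → ℕ) xs → sum (map (λ x → c * f x) xs) ≡ c * sum (map f xs)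
    sum-*ˡ c f []       = sym (ℕ.*-zeroʳ c)
    sum-*ˡ c f (x ∷ xs) = trans (cong (c * f x +_) (sum-*ˡ c f xs)) (sym (ℕ.*-distribˡ-+ c (f x) _))

    sum-*ʳ : ∀ c (f : A → ℕ) xs → sum (map f xs) * c ≡ sum (map (λ x → f x * c) xs)
    sum-*ʳ c f []       = refl
    sum-*ʳ c f (x ∷ xs) = trans (ℕ.*-distribʳ-+ c (f x) _) (cong (f x * c +_) (sum-*ʳ c f xs))

    sum-const : ∀ c (xs : List A) → sum (map (λ _ → c) xs) ≡ length xs * c
    sum-const c []       = refl
    sum-const c (x ∷ xs) = cong (c +_) (sum-const c xs)

    sum-+ : ∀ (f g : A → ℕ) xs → sum (map (λ x → f x + g x) xs) ≡ sum (map f xs) + sum (map g xs)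
    sum-+ f g []       = refl
    sum-+ f g (x ∷ xs) = trans (cong (f x + g x +_) (sum-+ f g xs)) (+-interchange (f x) (g x) _ _)

  count-allVecs-suc : ∀ {k m} {P : Pred (Vec (Fin k) (suc m)) 0ℓ} (P? : Decidable P) →
    count P? (allVecs k (suc m)) ≡ sum (map (λ i → count (λ w → P? (i ∷ᵥ w)) (allVecs k m)) (allFin k))
  count-allVecs-suc {k} {m} P? = trans (count-concat P? (map (λ i → map (i ∷ᵥ_) (allVecs k m)) (allFin k)))
    (trans (cong sum (sym (map-∘ (allFin k))))
           (sum-cong _ _ (allFin k) (λ {i} _ → count-map P? (i ∷ᵥ_) (allVecs k m))))

  length-allVecs : ∀ k m → length (allVecs k m) ≡ k ^ m
  length-allVecs k zero    = refl
  length-allVecs k (suc m) = begin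
    length (allVecs k (suc m))                                   ≡⟨ sym (count-all U? (allVecs k (suc m)) _) ⟩
    count U? (allVecs k (suc m))                                 ≡⟨ count-allVecs-suc U? ⟩
    sum (map (λ _ → count U? (allVecs k m)) (allFin k))          ≡⟨ sum-cong _ _ (allFin k) (λ _ → count-U? m) ⟩
    sum (map (λ _ → k ^ m) (allFin k))                           ≡⟨ sum-const (k ^ m) (allFin k) ⟩
    length (allFin k) * k ^ m                                    ≡⟨ cong (_* k ^ m) (length-tabulate {n = k} id) ⟩
    k * k ^ m                                                    ∎
    where
    open ≡-Reasoning
    U? : ∀ {m} → Decidable {A = Vec (Fin k) m} (λ _ → ⊤)
    U? _ = yes tt
    count-U? : ∀ m → count U? (allVecs k m) ≡ k ^ m
    count-U? m = trans (count-all U? (allVecs k m) _) (length-allVecs k m)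

  module _ {A : Set} (_≟_ : DecidableEquality A) where

    count-≡ : ∀ {xs x} → Unique xs → x ∈ xs → count (_≟ x) xs ≡ 1
    count-≡ {y ∷ xs} {x} (y∉ ∷ u) x∈ with y ≟ x | x∈
    ... | yes refl | _          = cong suc (count-none (_≟ y) xs (λ z∈ z≡y → All.lookup y∉ z∈ (sym z≡y)))
    ... | no y≢x   | here x≡y   = contradiction (sym x≡y) y≢x
    ... | no _     | there x∈xs = count-≡ u x∈xs

    count-≢ : ∀ {xs x} → Unique xs → x ∈ xs → count (λ y → ¬? (y ≟ x)) xs ≡ length xs ∸ 1
    count-≢ {xs} {x} u x∈ = begin
      c≢                         ≡⟨ ℕ.m+n∸m≡n 1 c≢ ⟨
      1 + c≢ ∸ 1                 ≡⟨ cong (λ c → c + c≢ ∸ 1) (count-≡ u x∈) ⟨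
      count (_≟ x) xs + c≢ ∸ 1   ≡⟨ cong (_∸ 1) (count-complement (_≟ x) xs) ⟩
      length xs ∸ 1              ∎
      where
      open ≡-Reasoning
      c≢ : ℕ
      c≢ = count (λ y → ¬? (y ≟ x)) xs

  module _ {I X : Set} {Q : Pred X 0ℓ} (Q? : Decidable Q) {R : I → X → Set} (R? : ∀ i w → Dec (R i w)) where

    private
      S? : ∀ i → Decidable (λ w → Q w × R i w)
      S? i w = Q? w ×-dec R? i w

      sum-count-[_] : ∀ w is → sum (map (λ i → count (S? i) [ w ]) is) ≡ count (λ i → S? i w) is
      sum-count-[ w ] []       = refl
      sum-count-[ w ] (i ∷ is) with does (S? i w)
      ... | true  = cong suc (sum-count-[ w ] is)
      ... | false = sum-count-[ w ] is

      count-S-column : ∀ is j w → count (λ i → R? i w) is ≡ j → count (λ i → S? i w) is ≡ j * count Q? [ w ]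
      count-S-column is j w hits = column (Q? w)
        where
        column : Dec (Q w) → count (λ i → S? i w) is ≡ j * count Q? [ w ]
        column (yes q) = begin
          count (λ i → S? i w) is   ≡⟨ count-cong (λ i → S? i w) (λ i → R? i w) is (λ _ → proj₂) (λ _ → q ,_) ⟩
          count (λ i → R? i w) is   ≡⟨ trans hits (sym (ℕ.*-identityʳ j)) ⟩
          j * 1                     ≡⟨ cong (j *_) (sym (count-all Q? [ w ] λ { (here refl) → q })) ⟩
          j * count Q? [ w ]        ∎
          where
          open ≡-Reasoning
        column (no ¬q) = begin
          count (λ i → S? i w) is   ≡⟨ count-none (λ i → S? i w) is (λ _ → ¬q ∘ proj₁) ⟩
          0                         ≡⟨ sym (ℕ.*-zeroʳ j) ⟩
          j * 0                     ≡⟨ cong (j *_) (sym (count-none Q? [ w ] λ { (here refl) → ¬q })) ⟩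
          j * count Q? [ w ]        ∎
          where
          open ≡-Reasoning

    -- Fubini: exchange the two summations.
    sum-count-× : ∀ is j → (∀ w → count (λ i → R? i w) is ≡ j) → ∀ ws →
                  sum (map (λ i → count (S? i) ws) is) ≡ j * count Q? ws
    sum-count-× is j hits []       = trans (sum-const 0 is) (trans (ℕ.*-zeroʳ (length is)) (sym (ℕ.*-zeroʳ j)))
    sum-count-× is j hits (w ∷ ws) = begin
      sum (map (λ i → count (S? i) (w ∷ ws)) is)
        ≡⟨ sum-cong _ _ is (λ {i} _ → count-∷ (S? i) w ws) ⟩
      sum (map (λ i → count (S? i) [ w ] + count (S? i) ws) is)
        ≡⟨ sum-+ _ _ is ⟩
      sum (map (λ i → count (S? i) [ w ]) is) + sum (map (λ i → count (S? i) ws) is)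
        ≡⟨ cong₂ _+_ (trans (sum-count-[ w ] is) (count-S-column is j w (hits w))) (sum-count-× is j hits ws) ⟩
      j * count Q? [ w ] + j * count Q? ws
        ≡⟨ ℕ.*-distribˡ-+ j _ _ ⟨
      j * (count Q? [ w ] + count Q? ws)
        ≡⟨ cong (j *_) (count-∷ Q? w ws) ⟨
      j * count Q? (w ∷ ws)
        ∎
      where
      open ≡-Reasoning

  Agree : ∀ {k m} → Fin m → Vec (Fin k) m → Vec (Fin k) m → Set
  Agree b v w = ∀ u → u ≢ b → lookup v u ≡ lookup w u

  -- As P and f ignore coordinate b, the constraint R keeps exactly j of the k values of that coordinate.
  count-constrained : ∀ {k} m (b : Fin m) {P : Pred (Vec (Fin k) m) 0ℓ} (P? : Decidable P)
    (f : Vec (Fin k) m → Fin k) {R : Fin k → Fin k → Set} (R? : ∀ i x → Dec (R i x)) j →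
    (∀ x → count (λ i → R? i x) (allFin k) ≡ j) →
    (∀ {v w} → Agree b v w → P v → P w) → (∀ {v w} → Agree b v w → f v ≡ f w) →
    count (λ v → P? v ×-dec R? (lookup v b) (f v)) (allVecs k m) * k ≡ j * count P? (allVecs k m)
  count-constrained {zero} (suc m) zero P? f R? j _ _ _ = sym (ℕ.*-zeroʳ j)
  count-constrained {suc k} (suc m) zero {P} P? f {R} R? j hits P-resp f-resp = begin
    count (λ v → P? v ×-dec R? (lookup v zero) (f v)) (allVecs (suc k) (suc m)) * suc k
      ≡⟨ cong (_* suc k) (count-allVecs-suc (λ v → P? v ×-dec R? (lookup v zero) (f v))) ⟩
    sum (map (λ i → count (λ w → P? (i ∷ᵥ w) ×-dec R? i (f (i ∷ᵥ w))) W) (allFin (suc k))) * suc k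
      ≡⟨ cong (_* suc k) (sum-cong _ _ (allFin (suc k)) (λ {i} _ → count-cong _ _ W
           (λ _ → map-× (P-resp (agree-head i zero)) (subst (R i) (f-resp (agree-head i zero))))
           (λ _ → map-× (P-resp (agree-head zero i)) (subst (R i) (f-resp (agree-head zero i)))))) ⟩
    sum (map (λ i → count (λ w → P? (zero ∷ᵥ w) ×-dec R? i (f (zero ∷ᵥ w))) W) (allFin (suc k))) * suc k
      ≡⟨ cong (_* suc k) (sum-count-× (λ w → P? (zero ∷ᵥ w)) (λ i w → R? i (f (zero ∷ᵥ w)))
                                      (allFin (suc k)) j (λ w → hits _) W) ⟩
    j * c * suc k
      ≡⟨ solve 3 (λ j c k → j :* c :* k := j :* (k :* c)) refl j c (suc k) ⟩
    j * (suc k * c)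
      ≡⟨ cong (j *_) (sym (trans (sum-cong _ _ (allFin (suc k)) (λ {i} _ → count-cong _ _ W
                                 (λ _ → P-resp (agree-head i zero)) (λ _ → P-resp (agree-head zero i))))
                           (trans (sum-const c (allFin (suc k))) (cong (_* c) (length-tabulate {n = suc k} id))))) ⟩
    j * sum (map (λ i → count (λ w → P? (i ∷ᵥ w)) W) (allFin (suc k)))
      ≡⟨ cong (j *_) (sym (count-allVecs-suc P?)) ⟩
    j * count P? (allVecs (suc k) (suc m))
      ∎
    where
    open ≡-Reasoning
    open +-*-Solver
    W : List (Vec (Fin (suc k)) m)
    W = allVecs (suc k) m
    c : ℕ
    c = count (λ w → P? (zero ∷ᵥ w)) W
    agree-head : ∀ i i′ {w : Vec (Fin (suc k)) m} → Agree zero (i ∷ᵥ w) (i′ ∷ᵥ w)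
    agree-head i i′ zero    0≢0 = contradiction refl 0≢0
    agree-head i i′ (suc u) _   = refl
  count-constrained {k} (suc m) (suc b) {P} P? f R? j hits P-resp f-resp = begin
    count (λ v → P? v ×-dec R? (lookup v (suc b)) (f v)) (allVecs k (suc m)) * k
      ≡⟨ cong (_* k) (count-allVecs-suc (λ v → P? v ×-dec R? (lookup v (suc b)) (f v))) ⟩
    sum (map (λ i → count (λ w → P? (i ∷ᵥ w) ×-dec R? (lookup w b) (f (i ∷ᵥ w))) W) (allFin k)) * k
      ≡⟨ sum-*ʳ k _ (allFin k) ⟩
    sum (map (λ i → count (λ w → P? (i ∷ᵥ w) ×-dec R? (lookup w b) (f (i ∷ᵥ w))) W * k) (allFin k))
      ≡⟨ sum-cong _ _ (allFin k) (λ {i} _ → count-constrained m b (λ w → P? (i ∷ᵥ w)) (λ w → f (i ∷ᵥ w))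
                                              R? j hits (P-resp ∘ agree-tail i) (f-resp ∘ agree-tail i)) ⟩
    sum (map (λ i → j * count (λ w → P? (i ∷ᵥ w)) W) (allFin k))
      ≡⟨ sum-*ˡ j _ (allFin k) ⟩
    j * sum (map (λ i → count (λ w → P? (i ∷ᵥ w)) W) (allFin k))
      ≡⟨ cong (j *_) (sym (count-allVecs-suc P?)) ⟩
    j * count P? (allVecs k (suc m))
      ∎
    where
    open ≡-Reasoning
    W : List (Vec (Fin k) m)
    W = allVecs k m
    agree-tail : ∀ i {v w} → Agree b v w → Agree (suc b) (i ∷ᵥ v) (i ∷ᵥ w)
    agree-tail i agree zero    _       = refl
    agree-tail i agree (suc u) su≢sb = agree u (su≢sb ∘ cong suc)

module _ {N k : ℕ} where

  Flowing : List (Edge N) → (Fin N → Fin k) → Set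
  Flowing T c = (∀ {e} → e ∈ T → c (proj₁ e) ≢ c (proj₂ e))
              × (∀ {e f} → e ∈ T → f ∈ T → proj₂ e ≡ proj₂ f → c (proj₁ e) ≡ c (proj₁ f))
              × (∀ {e f} → e ∈ T → f ∈ T → proj₁ e ≡ proj₁ f → c (proj₂ e) ≡ c (proj₂ f))

  -- Defs.IsFlowing with an arbitrary edge list in place of E G.
  FlowingAll : List (Edge N) → (Fin N → Fin k) → Set
  FlowingAll T c =
    All (λ e → c (proj₁ e) ≢ c (proj₂ e)) T ×
    All (λ e → All (λ e′ → proj₂ e ≡ proj₂ e′ → c (proj₁ e) ≡ c (proj₁ e′)) T) T ×
    All (λ e → All (λ e′ → proj₁ e ≡ proj₁ e′ → c (proj₂ e) ≡ c (proj₂ e′)) T) T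

  FlowingAll⇒Flowing : ∀ {T c} → FlowingAll T c → Flowing T c
  FlowingAll⇒Flowing (p , h , t) =
    All.lookup p , (λ e∈ f∈ → All.lookup (All.lookup h e∈) f∈) , (λ e∈ f∈ → All.lookup (All.lookup t e∈) f∈)

  Flowing⇒FlowingAll : ∀ {T c} → Flowing T c → FlowingAll T c
  Flowing⇒FlowingAll (p , h , t) =
    All.tabulate p , All.tabulate (λ e∈ → All.tabulate (h e∈)) , All.tabulate (λ e∈ → All.tabulate (t e∈))

  flowing? : ∀ T c → Dec (Flowing T c)
  flowing? T c = map′ FlowingAll⇒Flowing Flowing⇒FlowingAll
    (all? (λ e → ¬? (c (proj₁ e) ≟ c (proj₂ e))) T ×-dec
     all? (λ e → all? (λ e′ → (proj₂ e ≟ proj₂ e′) →-dec (c (proj₁ e) ≟ c (proj₁ e′))) T) T ×-dec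
     all? (λ e → all? (λ e′ → (proj₁ e ≟ proj₁ e′) →-dec (c (proj₂ e) ≟ c (proj₂ e′))) T) T)

  flowing-⊆ : ∀ {T T′ c} → T′ ⊆ˢ T → Flowing T c → Flowing T′ c
  flowing-⊆ T′⊆T (p , h , t) = p ∘ T′⊆T , (λ e∈ f∈ → h (T′⊆T e∈) (T′⊆T f∈)) , (λ e∈ f∈ → t (T′⊆T e∈) (T′⊆T f∈))

  flowing-agree : ∀ {T c c′} → (∀ {e} → e ∈ T → c (proj₁ e) ≡ c′ (proj₁ e) × c (proj₂ e) ≡ c′ (proj₂ e)) →
                  Flowing T c → Flowing T c′
  flowing-agree agree (p , h , t) =
    (λ e∈ eq → p e∈ (trans (proj₁ (agree e∈)) (trans eq (sym (proj₂ (agree e∈)))))) ,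
    (λ e∈ f∈ eq → trans (sym (proj₁ (agree e∈))) (trans (h e∈ f∈ eq) (proj₁ (agree f∈)))) ,
    (λ e∈ f∈ eq → trans (sym (proj₂ (agree e∈))) (trans (t e∈ f∈ eq) (proj₂ (agree f∈))))

  flowing-∷ : ∀ {e T c} → Flowing T c → c (proj₁ e) ≢ c (proj₂ e) →
    (∀ {f} → f ∈ T → proj₂ f ≡ proj₂ e → c (proj₁ f) ≡ c (proj₁ e)) →
    (∀ {f} → f ∈ T → proj₁ f ≡ proj₁ e → c (proj₂ f) ≡ c (proj₂ e)) → Flowing (e ∷ T) c
  flowing-∷ {e} {T} {c} (p , h , t) proper heads tails = p′ , h′ , t′
    where
    p′ : ∀ {f} → f ∈ e ∷ T → c (proj₁ f) ≢ c (proj₂ f)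
    p′ (here refl) = proper
    p′ (there f∈)  = p f∈
    h′ : ∀ {f f′} → f ∈ e ∷ T → f′ ∈ e ∷ T → proj₂ f ≡ proj₂ f′ → c (proj₁ f) ≡ c (proj₁ f′)
    h′ (here refl) (here refl) _  = refl
    h′ (here refl) (there f∈)  eq = sym (heads f∈ (sym eq))
    h′ (there f∈)  (here refl) eq = heads f∈ eq
    h′ (there f∈)  (there f′∈) eq = h f∈ f′∈ eq
    t′ : ∀ {f f′} → f ∈ e ∷ T → f′ ∈ e ∷ T → proj₁ f ≡ proj₁ f′ → c (proj₂ f) ≡ c (proj₂ f′)
    t′ (here refl) (here refl) _  = refl
    t′ (here refl) (there f∈)  eq = sym (tails f∈ (sym eq))
    t′ (there f∈)  (here refl) eq = tails f∈ eq
    t′ (there f∈)  (there f′∈) eq = t f∈ f′∈ eq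

-- The multipath matroid of an MP-tree

module MultipathMatroid (G : Digraph) (mpt : IsMPTree G) where
  open import Data.Integer using (+_; -_; _-_; _*_; _^_)

  private
    V : Set
    V = Fin (n G)

    Ed : Set
    Ed = Edge (n G)

  no-DB : ¬ ContainsDB (E G)
  no-DB = proj₁ (proj₂ (proj₂ (proj₁ (proj₁ mpt))))

  no-DBrev : ¬ ContainsDBrev (E G)
  no-DBrev = proj₂ (proj₂ (proj₂ (proj₁ (proj₁ mpt))))

  mp2 : MP2 (E G)
  mp2 = proj₂ (proj₁ mpt)

  acyclic : ¬ HasUndirectedCycle (E G)
  acyclic = proj₂ (proj₂ (proj₂ mpt))

  noLoop : ∀ {a b} → (a , b) ∈ E G → a ≢ b
  noLoop = All.lookup (noLoops G)

  no-triangle : ∀ {a b c} → a ≢ b → a ≢ c → b ≢ c → Adj (E G) a b → Adj (E G) b c → Adj (E G) c a → ⊥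
  no-triangle a≢b a≢c b≢c ab bc ca = acyclic
    (_ ∷ _ ∷ _ ∷ [] , s≤s (s≤s (s≤s z≤n)) , ((a≢b ∷ a≢c ∷ []) ∷ (b≢c ∷ []) ∷ [] ∷ []) , ab ∷ bc ∷ ca ∷ [])

  Conflict : Ed → Ed → Set
  Conflict e f = proj₂ e ≡ proj₂ f ⊎ proj₁ e ≡ proj₁ f ⊎ (proj₁ e ≡ proj₂ f × proj₂ e ≡ proj₁ f)

  conflict? : ∀ e f → Dec (Conflict e f)
  conflict? e f =
    (proj₂ e ≟ proj₂ f) ⊎-dec (proj₁ e ≟ proj₁ f) ⊎-dec ((proj₁ e ≟ proj₂ f) ×-dec (proj₂ e ≟ proj₁ f))

  conflict-refl : ∀ {e} → Conflict e e
  conflict-refl = inj₁ refl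

  conflict-sym : ∀ {e f} → Conflict e f → Conflict f e
  conflict-sym (inj₁ h)                = inj₁ (sym h)
  conflict-sym (inj₂ (inj₁ t))         = inj₂ (inj₁ (sym t))
  conflict-sym (inj₂ (inj₂ (t , h)))   = inj₂ (inj₂ (sym h , sym t))

  -- MP2 applied to the cycle a → b → a.
  digon-isolated : ∀ {a b g} → (a , b) ∈ E G → (b , a) ∈ E G → g ∈ E G → Conflict (a , b) g →
                   g ∈ (a , b) ∷ (b , a) ∷ []
  digon-isolated ab∈ ba∈ g∈ ab~g = mp2 (_ ∷ _ ∷ [])
    (s≤s (s≤s z≤n) , ((noLoop ab∈ ∷ []) ∷ [] ∷ []) , ab∈ ∷ ba∈ ∷ []) g∈ (touches ab~g)
    where
    touches : ∀ {a b g} → Conflict (a , b) g → proj₁ g ∈ a ∷ b ∷ [] ⊎ proj₂ g ∈ a ∷ b ∷ []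
    touches (inj₁ b≡)             = inj₂ (there (here (sym b≡)))
    touches (inj₂ (inj₁ a≡))      = inj₁ (here (sym a≡))
    touches (inj₂ (inj₂ (a≡ , _))) = inj₂ (here (sym a≡))

  digon-conflict : ∀ {a b g} → g ∈ (b , a) ∷ (a , b) ∷ [] → Conflict (a , b) g
  digon-conflict (here refl)         = inj₂ (inj₂ (refl , refl))
  digon-conflict (there (here refl)) = conflict-refl

  -- Mixed head/tail conflicts that do not collapse would form D_B, its reversal (excluded by MP1) or a
  -- triangle (excluded by acyclicity); a digon conflicts with nothing outside itself by MP2.
  conflict-trans : ∀ {e f g} → e ∈ E G → f ∈ E G → g ∈ E G → Conflict e f → Conflict f g → Conflict e g
  conflict-trans e∈ f∈ g∈ (inj₂ (inj₂ (refl , refl))) f~g = digon-conflict (digon-isolated f∈ e∈ g∈ f~g)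
  conflict-trans e∈ f∈ g∈ e~f (inj₂ (inj₂ (refl , refl))) =
    conflict-sym (digon-conflict (digon-isolated f∈ g∈ e∈ (conflict-sym e~f)))
  conflict-trans _ _ _ (inj₁ h₁)        (inj₁ h₂)        = inj₁ (trans h₁ h₂)
  conflict-trans _ _ _ (inj₂ (inj₁ t₁)) (inj₂ (inj₁ t₂)) = inj₂ (inj₁ (trans t₁ t₂))
  conflict-trans {a , b} {c , _} {_ , q} e∈ f∈ g∈ (inj₁ refl) (inj₂ (inj₁ refl)) with a ≟ c | b ≟ q
  ... | yes a≡c | _       = inj₂ (inj₁ a≡c)
  ... | no _    | yes b≡q = inj₁ b≡q
  ... | no a≢c  | no b≢q with a ≟ q
  ...   | yes refl = ⊥-elim (no-triangle (noLoop e∈) a≢c (noLoop f∈ ∘ sym) (inj₁ e∈) (inj₂ f∈) (inj₁ g∈))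
  ...   | no a≢q   = ⊥-elim (no-DB
                       (a , b , c , q , noLoop e∈ , a≢c , a≢q , noLoop f∈ ∘ sym , b≢q , noLoop g∈ , e∈ , f∈ , g∈))
  conflict-trans {a , b} {_ , d} {p , _} e∈ f∈ g∈ (inj₂ (inj₁ refl)) (inj₁ refl) with a ≟ p | b ≟ d
  ... | yes a≡p | _       = inj₂ (inj₁ a≡p)
  ... | no _    | yes b≡d = inj₁ b≡d
  ... | no a≢p  | no b≢d with p ≟ b
  ...   | yes refl = ⊥-elim (no-triangle (noLoop e∈) (noLoop f∈) b≢d (inj₁ e∈) (inj₁ g∈) (inj₂ f∈))
  ...   | no p≢b   = ⊥-elim (no-DBrev
                       (b , a , d , p , noLoop e∈ ∘ sym , b≢d , p≢b ∘ sym , noLoop f∈ , a≢p , noLoop g∈ ∘ sym ,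
                        e∈ , f∈ , g∈))

  open PartitionMatroid (≡-dec _≟_ _≟_) conflict? conflict-refl conflict-sym (E G) conflict-trans public

  private
    walkVertices : ∀ {S u w m} → DWalk S u w m → List V
    walkVertices here           = []
    walkVertices (step {u} _ W) = u ∷ walkVertices W

    walk-pairs : ∀ {S u w m} (W : DWalk S u w m) → All (_∈ S) (pairs (walkVertices W ++ [ w ]))
    walk-pairs here                   = []
    walk-pairs (step e here)          = e ∷ []
    walk-pairs (step e W@(step _ _))  = e ∷ walk-pairs W

  -- A shortest directed cycle in S is a loop, a digon (whose edges conflict) or an undirected cycle.
  independent-acyclic : ∀ {S} → S ⊆ˢ E G → Independent S → ¬ HasDirectedCycle S
  independent-acyclic {S} S⊆E indep (v , _ , W@(step _ W′)) with simple-cycle S v (walkVertices W′) closed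
    where
    closed : cycleEdges (v ∷ walkVertices W′) ⊆ˢ S
    closed {e} e∈ = All.lookup (walk-pairs W) (subst (e ∈_) (cycleEdges-pairs v (walkVertices W′)) e∈)
  ... | _ , []         , _                 , cyc⊆S = noLoop (S⊆E (cyc⊆S (here refl))) refl
  ... | _ , _ ∷ []     , (u≢w ∷ []) ∷ _    , cyc⊆S =
        u≢w (cong proj₁ (indep (cyc⊆S (here refl)) (cyc⊆S (there (here refl))) (inj₂ (inj₂ (refl , refl)))))
  ... | u , w ∷ x ∷ us , uniq              , cyc⊆S =
        acyclic (u ∷ w ∷ x ∷ us , s≤s (s≤s (s≤s z≤n)) , uniq , All.tabulate (inj₁ ∘ S⊆E ∘ cyc⊆S))

  multipath⇒independent : ∀ {B} → IsMultipath B → Independent B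
  multipath⇒independent (in≤1 , _ , _)      e∈ f∈ (inj₁ h)        = in≤1 e∈ f∈ h
  multipath⇒independent (_ , out≤1 , _)     e∈ f∈ (inj₂ (inj₁ t)) = out≤1 e∈ f∈ t
  multipath⇒independent (_ , _ , no-cycle) {a , b} e∈ f∈ (inj₂ (inj₂ (refl , refl))) =
    ⊥-elim (no-cycle (a , 1 , step e∈ (step f∈ here)))

  independent⇒multipath : ∀ {B} → B ⊆ˢ E G → Independent B → IsMultipath B
  independent⇒multipath B⊆E indep =
    (λ e∈ f∈ → indep e∈ f∈ ∘ inj₁) , (λ e∈ f∈ → indep e∈ f∈ ∘ inj₂ ∘ inj₁) , independent-acyclic B⊆E indep

  rank≡ρ : ∀ r → IsMultipathRank G r → ∀ A → A ⊆ E G → r A ≡ ρ A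
  rank≡ρ r rank A A⊆E with rank A A⊆E
  ... | (B , B⊆A , B-multipath , |B|≡rA) , maximal = ℕ.≤-antisym
    (subst (_≤ ρ A) |B|≡rA (independent-length≤ρ A (Any-resp-⊆ A⊆E) B-unique
                             (multipath⇒independent B-multipath) (Any-resp-⊆ B⊆A)))
    (maximal (representatives A) (representatives-⊆ A)
             (independent⇒multipath reps⊆E (representatives-independent A)))
    where
    B-unique : Unique B
    B-unique = Unique-resp-⊆ B⊆A (Unique-resp-⊆ A⊆E (unique G))
    reps⊆E : representatives A ⊆ˢ E G
    reps⊆E = Any-resp-⊆ A⊆E ∘ Any-resp-⊆ (representatives-⊆ A)

  tutte-at-1-k : ∀ r → IsMultipathRank G r → ∀ k →
                 tutte G r (+ 1 - + k) (+ 0) ≡ sign (ρ (E G)) * (+ k - + 1) ^ ρ (E G)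
  tutte-at-1-k r rank k = begin
    tutte G r (+ 1 - + k) (+ 0)
      ≡⟨ cong sumℤ (map-cong-local (All.tabulate summand)) ⟩
    sumℤ (map (λ A → sign (ρ (E G)) * term (E G) [] A) (subsets (E G)))
      ≡⟨ cong sumℤ (map-∘ (subsets (E G))) ⟩
    sumℤ (map (sign (ρ (E G)) *_) (map (term (E G) []) (subsets (E G))))
      ≡⟨ sumℤ-*ˡ (sign (ρ (E G))) (map (term (E G) []) (subsets (E G))) ⟩
    sign (ρ (E G)) * signedSum (E G) []
      ≡⟨ cong (sign (ρ (E G)) *_) signedSum-ground ⟩
    sign (ρ (E G)) * (+ k - + 1) ^ ρ (E G)
      ∎
    where
    open ≡-Reasoning
    open SignedSum (+ k)
    summand : ∀ {A} → A ∈ subsets (E G) →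
      ((+ 1 - + k) - + 1) ^ (r (E G) ∸ r A) * (+ 0 - + 1) ^ (length A ∸ r A) ≡ sign (ρ (E G)) * term (E G) [] A
    summand {A} A∈ = begin
      ((+ 1 - + k) - + 1) ^ (r (E G) ∸ r A) * (+ 0 - + 1) ^ (length A ∸ r A)
        ≡⟨ cong₂ (λ a c → ((+ 1 - + k) - + 1) ^ (a ∸ c) * (+ 0 - + 1) ^ (length A ∸ c))
                 (rank≡ρ r rank (E G) ⊆-refl) (rank≡ρ r rank A A⊆E) ⟩
      ((+ 1 - + k) - + 1) ^ (ρ (E G) ∸ ρ A) * (+ 0 - + 1) ^ (length A ∸ ρ A)
        ≡⟨ tutte-summand k (ρ-mono id (Any-resp-⊆ A⊆E)) (ρ≤length A) ⟩
      sign (ρ (E G)) * (sign (length A) * (+ k) ^ (ρ (E G) ∸ ρ A))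
        ≡⟨ cong₂ (λ L B → sign (ρ (E G)) * (sign (length A) * (+ k) ^ (ρ L ∸ ρ B)))
                 (++-identityʳ (E G)) (++-identityʳ A) ⟨
      sign (ρ (E G)) * term (E G) [] A
        ∎
      where
      A⊆E : A ⊆ E G
      A⊆E = subsets-⊆ (E G) A∈

-- Flowing colourings of an MP-tree

module FlowingColourings (G : Digraph) (mpt : IsMPTree G) where
  open import Data.Nat using (_+_; _*_; _^_)
  open import Data.Nat.Solver using (module +-*-Solver)
  open MultipathMatroid G mpt
  open DecMembership (_≟_ {n G}) using (_∈?_)
  open DecMembership (≡-dec (_≟_ {n G}) (_≟_ {n G})) using () renaming (_∈?_ to _∈ₑ?_)

  private
    V : Set
    V = Fin (n G)

    Ed : Set
    Ed = Edge (n G)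

  data Path : V → V → List V → Set where
    end : ∀ x → Path x x [ x ]
    _∷_ : ∀ {x y z ps} → Adj (E G) x y → Path y z ps → Path x z (x ∷ ps)

  adj-sym : ∀ {a b} → Adj (E G) a b → Adj (E G) b a
  adj-sym (inj₁ ab) = inj₂ ab
  adj-sym (inj₂ ba) = inj₁ ba

  path-head : ∀ {x y ps} → Path x y ps → ∃[ tl ] (ps ≡ x ∷ tl)
  path-head (end _)          = [] , refl
  path-head (_∷_ {ps = ps} _ _) = ps , refl

  path-snoc : ∀ {x a ps b} → Path x a ps → Adj (E G) a b → Path x b (ps ++ [ b ])
  path-snoc (end _) ab = ab ∷ end _
  path-snoc (xy ∷ P) ab = xy ∷ path-snoc P ab

  path-pairs : ∀ {x y ps b} → Path x y ps → Adj (E G) y b →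
               All (λ e → Adj (E G) (proj₁ e) (proj₂ e)) (pairs (ps ++ [ b ]))
  path-pairs (end _) yb = yb ∷ []
  path-pairs (xy ∷ P) yb with path-head P
  ... | _ , refl = xy ∷ path-pairs P yb

  Linked : List V → Set
  Linked Vs = ∀ {x y} → x ∈ Vs → y ∈ Vs → ∃[ ps ] (Path x y ps × Unique ps × ps ⊆ˢ Vs)

  -- Two neighbours of b in Vs, joined by a simple path inside Vs, would close a cycle through b.
  unique-neighbour : ∀ {Vs a a′ b} → Linked Vs → b ∉ Vs → a ∈ Vs → a′ ∈ Vs →
                     Adj (E G) a b → Adj (E G) a′ b → a ≡ a′
  unique-neighbour linked b∉ a∈ a′∈ ab a′b with linked a∈ a′∈
  ... | _ , end _ , _ , _ = refl
  ... | _ , P@(_∷_ {ps = qs} _ Q) , uniq , ps⊆ with path-head Q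
  ...   | _ , refl = ⊥-elim (acyclic (_ ∷ _ ∷ qs , s≤s (s≤s (s≤s z≤n)) ,
                                      All.tabulate (λ { z∈ refl → b∉ (ps⊆ z∈) }) ∷ uniq ,
                                      subst (All _) (sym (cycleEdges-pairs _ (_ ∷ qs)))
                                            (adj-sym ab ∷ path-pairs P a′b)))

  linked-∷ : ∀ {Vs a b} → Linked Vs → a ∈ Vs → b ∉ Vs → Adj (E G) a b → Linked (b ∷ Vs)
  linked-∷ {b = b} _ _ _ _ (here refl) (here refl) = [ b ] , end b , [] ∷ [] , λ { (here refl) → here refl }
  linked-∷ {b = b} linked a∈ b∉ ab (here refl) (there y∈) with ps , P , uniq , ps⊆ ← linked a∈ y∈ =
    b ∷ ps , adj-sym ab ∷ P , All.tabulate (λ { z∈ refl → b∉ (ps⊆ z∈) }) ∷ uniq ,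
    λ { (here refl) → here refl ; (there z∈) → there (ps⊆ z∈) }
  linked-∷ {b = b} linked a∈ b∉ ab (there x∈) (here refl) with ps , P , uniq , ps⊆ ← linked x∈ a∈ =
    ps ++ [ b ] , path-snoc P ab , Unique.++⁺ uniq ([] ∷ []) (λ { (z∈ , here refl) → b∉ (ps⊆ z∈) }) ,
    [ there ∘ ps⊆ , (λ { (here refl) → here refl }) ]′ ∘ ∈-++⁻ ps
  linked-∷ linked _ _ _ (there x∈) (there y∈) with ps , P , uniq , ps⊆ ← linked x∈ y∈ =
    ps , P , uniq , there ∘ ps⊆

  nonempty : 1 ≤ n G
  nonempty = proj₁ (proj₂ mpt)

  connected : Connected (E G)
  connected = proj₁ (proj₂ (proj₂ mpt))

  root : V
  root = fromℕ< nonempty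

  record Subtree : Set where
    field
      Vs        : List V
      T         : List Ed
      root∈     : root ∈ Vs
      T⊆E       : T ⊆ˢ E G
      T-inside  : ∀ {e} → e ∈ T → proj₁ e ∈ Vs × proj₂ e ∈ Vs
      T-induced : ∀ {e} → e ∈ E G → proj₁ e ∈ Vs → proj₂ e ∈ Vs → e ∈ T
      linked    : Linked Vs

  start : Subtree
  start = record
    { Vs = [ root ] ; T = [] ; root∈ = here refl ; T⊆E = λ () ; T-inside = λ ()
    ; T-induced = λ { e∈ (here refl) (here refl) → contradiction refl (noLoop e∈) }
    ; linked = λ { (here refl) (here refl) → [ root ] , end root , [] ∷ [] , λ { (here refl) → here refl } } }

  data Constraint : Set where
    same distinct : Constraint

  Holds : ∀ {k} → Constraint → Fin k → Fin k → Set
  Holds same     i x = i ≡ x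
  Holds distinct i x = i ≢ x

  holds? : ∀ {k} κ (i x : Fin k) → Dec (Holds κ i x)
  holds? same     i x = i ≟ x
  holds? distinct i x = ¬? (i ≟ x)

  growth : Constraint → ℕ
  growth same     = 0
  growth distinct = 1

  module Attach (g : Subtree) {a b : V} (a∈ : a ∈ Subtree.Vs g) (b∉ : b ∉ Subtree.Vs g) (ab : Adj (E G) a b)
    where
    open Subtree g

    ∈Vs⇒≢b : ∀ {u} → u ∈ Vs → u ≢ b
    ∈Vs⇒≢b u∈ refl = b∉ u∈

    tail≢b : ∀ {f} → f ∈ T → proj₁ f ≢ b
    tail≢b = ∈Vs⇒≢b ∘ proj₁ ∘ T-inside

    head≢b : ∀ {f} → f ∈ T → proj₂ f ≢ b
    head≢b = ∈Vs⇒≢b ∘ proj₂ ∘ T-inside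

    a≢b : a ≢ b
    a≢b = ∈Vs⇒≢b a∈

    -- The edges between b and Vs, with the constraint a flowing colouring puts on the colour of b.
    record Attachment : Set where
      field
        new        : List Ed
        new⊆E      : new ⊆ˢ E G
        new⊆ab     : new ⊆ˢ (a , b) ∷ (b , a) ∷ []
        ab-new     : (a , b) ∈ E G → (a , b) ∈ new
        ba-new     : (b , a) ∈ E G → (b , a) ∈ new
        anchor     : V
        anchor∈    : anchor ∈ Vs
        constraint : Constraint
        flowing⇒   : ∀ {k} {c : V → Fin k} → Flowing (new ++ T) c →
                     Flowing T c × Holds constraint (c b) (c anchor)
        flowing⇐   : ∀ {k} {c : V → Fin k} → Flowing T c → Holds constraint (c b) (c anchor) →
                     Flowing (new ++ T) c
        ρ-growth   : ρ (new ++ T) ≡ growth constraint + ρ T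

    extend : Attachment → Subtree
    extend att = record
      { Vs = b ∷ Vs ; T = new ++ T ; root∈ = there root∈
      ; T⊆E = T′⊆E ; T-inside = T′-inside ; T-induced = T′-induced ; linked = linked-∷ linked a∈ b∉ ab }
      where
      open Attachment att
      T′⊆E : new ++ T ⊆ˢ E G
      T′⊆E e∈ with ∈-++⁻ new e∈
      ... | inj₁ e∈new = new⊆E e∈new
      ... | inj₂ e∈T   = T⊆E e∈T
      T′-inside : ∀ {e} → e ∈ new ++ T → proj₁ e ∈ b ∷ Vs × proj₂ e ∈ b ∷ Vs
      T′-inside e∈ with ∈-++⁻ new e∈
      ... | inj₂ e∈T = there (proj₁ (T-inside e∈T)) , there (proj₂ (T-inside e∈T))
      ... | inj₁ e∈new with new⊆ab e∈new
      ...   | here refl         = there a∈ , here refl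
      ...   | there (here refl) = here refl , there a∈
      T′-induced : ∀ {e} → e ∈ E G → proj₁ e ∈ b ∷ Vs → proj₂ e ∈ b ∷ Vs → e ∈ new ++ T
      T′-induced e∈ (here refl) (here refl) = contradiction refl (noLoop e∈)
      T′-induced e∈ (here refl) (there y∈) with refl ← unique-neighbour linked b∉ y∈ a∈ (inj₂ e∈) ab =
        ∈-++⁺ˡ (ba-new e∈)
      T′-induced e∈ (there x∈) (here refl) with refl ← unique-neighbour linked b∉ x∈ a∈ (inj₁ e∈) ab =
        ∈-++⁺ˡ (ab-new e∈)
      T′-induced e∈ (there x∈) (there y∈) = ∈-++⁺ʳ new (T-induced e∈ x∈ y∈)

    -- A new edge sharing its end a with an edge f of T forces b to take the colour of the other end of f;
    -- a new edge opening a class only forbids the colour of a.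
    attach-tail-joined : (a , b) ∈ E G → (b , a) ∉ E G → ∀ {f} → f ∈ T → proj₁ f ≡ a → Attachment
    attach-tail-joined ab∈ ba∉ {f} f∈ f-tail = record
      { new = [ (a , b) ] ; new⊆E = λ { (here refl) → ab∈ } ; new⊆ab = λ { (here refl) → here refl }
      ; ab-new = λ _ → here refl ; ba-new = λ ba∈ → contradiction ba∈ ba∉
      ; anchor = proj₂ f ; anchor∈ = proj₂ (T-inside f∈) ; constraint = same
      ; flowing⇒ = λ fl → flowing-⊆ there fl , proj₂ (proj₂ fl) (here refl) (there f∈) (sym f-tail)
      ; flowing⇐ = λ { {c = c} fl@(proper , _ , tails) cb≡cy → flowing-∷ fl
          (λ ca≡cb → proper f∈ (trans (cong c f-tail) (trans ca≡cb cb≡cy)))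
          (λ f′∈ f′-head → ⊥-elim (head≢b f′∈ f′-head))
          (λ f′∈ f′-tail → trans (tails f′∈ f∈ (trans f′-tail (sym f-tail))) (sym cb≡cy)) }
      ; ρ-growth = ρ-∷-related (lose f∈ (inj₂ (inj₁ (sym f-tail)))) }

    attach-head-joined : (b , a) ∈ E G → (a , b) ∉ E G → ∀ {f} → f ∈ T → proj₂ f ≡ a → Attachment
    attach-head-joined ba∈ ab∉ {f} f∈ f-head = record
      { new = [ (b , a) ] ; new⊆E = λ { (here refl) → ba∈ } ; new⊆ab = λ { (here refl) → there (here refl) }
      ; ab-new = λ ab∈ → contradiction ab∈ ab∉ ; ba-new = λ _ → here refl
      ; anchor = proj₁ f ; anchor∈ = proj₁ (T-inside f∈) ; constraint = same
      ; flowing⇒ = λ fl → flowing-⊆ there fl , proj₁ (proj₂ fl) (here refl) (there f∈) (sym f-head)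
      ; flowing⇐ = λ { {c = c} fl@(proper , heads , _) cb≡cy → flowing-∷ fl
          (λ cb≡ca → proper f∈ (trans (sym cb≡cy) (trans cb≡ca (sym (cong c f-head)))))
          (λ f′∈ f′-head → trans (heads f′∈ f∈ (trans f′-head (sym f-head))) (sym cb≡cy))
          (λ f′∈ f′-tail → ⊥-elim (tail≢b f′∈ f′-tail)) }
      ; ρ-growth = ρ-∷-related (lose f∈ (inj₁ (sym f-head))) }

    attach-tail-new : (a , b) ∈ E G → (b , a) ∉ E G → ¬ Any (λ f → proj₁ f ≡ a) T → Attachment
    attach-tail-new ab∈ ba∉ no-tail = record
      { new = [ (a , b) ] ; new⊆E = λ { (here refl) → ab∈ } ; new⊆ab = λ { (here refl) → here refl }
      ; ab-new = λ _ → here refl ; ba-new = λ ba∈ → contradiction ba∈ ba∉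
      ; anchor = a ; anchor∈ = a∈ ; constraint = distinct
      ; flowing⇒ = λ fl → flowing-⊆ there fl , proj₁ fl (here refl) ∘ sym
      ; flowing⇐ = λ fl cb≢ca → flowing-∷ fl (cb≢ca ∘ sym)
          (λ f′∈ f′-head → ⊥-elim (head≢b f′∈ f′-head)) (λ f′∈ f′-tail → ⊥-elim (no-tail (lose f′∈ f′-tail)))
      ; ρ-growth = ρ-∷-unrelated unrelated }
      where
      unrelated : ¬ Related (a , b) T
      unrelated r with f , f∈ , ab~f ← find r with ab~f
      ... | inj₁ b≡                = head≢b f∈ (sym b≡)
      ... | inj₂ (inj₁ a≡)         = no-tail (lose f∈ (sym a≡))
      ... | inj₂ (inj₂ (_ , b≡))   = tail≢b f∈ (sym b≡)

    attach-head-new : (b , a) ∈ E G → (a , b) ∉ E G → ¬ Any (λ f → proj₂ f ≡ a) T → Attachment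
    attach-head-new ba∈ ab∉ no-head = record
      { new = [ (b , a) ] ; new⊆E = λ { (here refl) → ba∈ } ; new⊆ab = λ { (here refl) → there (here refl) }
      ; ab-new = λ ab∈ → contradiction ab∈ ab∉ ; ba-new = λ _ → here refl
      ; anchor = a ; anchor∈ = a∈ ; constraint = distinct
      ; flowing⇒ = λ fl → flowing-⊆ there fl , proj₁ fl (here refl)
      ; flowing⇐ = λ fl cb≢ca → flowing-∷ fl cb≢ca
          (λ f′∈ f′-head → ⊥-elim (no-head (lose f′∈ f′-head))) (λ f′∈ f′-tail → ⊥-elim (tail≢b f′∈ f′-tail))
      ; ρ-growth = ρ-∷-unrelated unrelated }
      where
      unrelated : ¬ Related (b , a) T
      unrelated r with f , f∈ , ba~f ← find r with ba~f
      ... | inj₁ a≡                = no-head (lose f∈ (sym a≡))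
      ... | inj₂ (inj₁ b≡)         = tail≢b f∈ (sym b≡)
      ... | inj₂ (inj₂ (b≡ , _))   = head≢b f∈ (sym b≡)

    attach-digon : (a , b) ∈ E G → (b , a) ∈ E G → Attachment
    attach-digon ab∈ ba∈ = record
      { new = (a , b) ∷ (b , a) ∷ [] ; new⊆ab = id
      ; new⊆E = λ { (here refl) → ab∈ ; (there (here refl)) → ba∈ }
      ; ab-new = λ _ → here refl ; ba-new = λ _ → there (here refl)
      ; anchor = a ; anchor∈ = a∈ ; constraint = distinct
      ; flowing⇒ = λ fl → flowing-⊆ (there ∘ there) fl , proj₁ fl (here refl) ∘ sym
      ; flowing⇐ = λ fl cb≢ca → flowing-∷ (flowing-∷ fl cb≢ca
            (λ f′∈ f′-head → ⊥-elim (head≢a f′∈ f′-head)) (λ f′∈ f′-tail → ⊥-elim (tail≢b f′∈ f′-tail)))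
          (cb≢ca ∘ sym)
          (λ { (here refl) a≡b → ⊥-elim (a≢b a≡b) ; (there f′∈) f′-head → ⊥-elim (head≢b f′∈ f′-head) })
          (λ { (here refl) b≡a → ⊥-elim (a≢b (sym b≡a)) ; (there f′∈) f′-tail → ⊥-elim (tail≢a f′∈ f′-tail) })
      ; ρ-growth = trans (ρ-∷-related {L = (b , a) ∷ T} (here (inj₂ (inj₂ (refl , refl)))))
                         (ρ-∷-unrelated unrelated) }
      where
      -- By MP2 the digon is a whole component, so no edge of T touches a.
      tail≢a : ∀ {f} → f ∈ T → proj₁ f ≢ a
      tail≢a f∈ f-tail with digon-isolated ab∈ ba∈ (T⊆E f∈) (inj₂ (inj₁ (sym f-tail)))
      ... | here refl         = head≢b f∈ refl
      ... | there (here refl) = tail≢b f∈ refl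
      head≢a : ∀ {f} → f ∈ T → proj₂ f ≢ a
      head≢a f∈ f-head with digon-isolated ba∈ ab∈ (T⊆E f∈) (inj₁ (sym f-head))
      ... | here refl         = tail≢b f∈ refl
      ... | there (here refl) = head≢b f∈ refl
      unrelated : ¬ Related (b , a) T
      unrelated r with f , f∈ , ba~f ← find r with ba~f
      ... | inj₁ a≡                = head≢a f∈ (sym a≡)
      ... | inj₂ (inj₁ b≡)         = tail≢b f∈ (sym b≡)
      ... | inj₂ (inj₂ (b≡ , _))   = head≢b f∈ (sym b≡)

    attachment : Attachment
    attachment with (a , b) ∈ₑ? E G | (b , a) ∈ₑ? E G
    ... | yes ab∈ | yes ba∈ = attach-digon ab∈ ba∈
    ... | no ab∉  | no ba∉  = ⊥-elim ([ ab∉ , ba∉ ]′ ab)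
    ... | yes ab∈ | no ba∉ with any? (λ (f : Ed) → proj₁ f ≟ a) T
    ...   | yes tail-a with f , f∈ , f-tail ← find tail-a = attach-tail-joined ab∈ ba∉ f∈ f-tail
    ...   | no ¬tail-a = attach-tail-new ab∈ ba∉ ¬tail-a
    attachment | no ab∉ | yes ba∈ with any? (λ (f : Ed) → proj₂ f ≟ a) T
    ...   | yes head-a with f , f∈ , f-head ← find head-a = attach-head-joined ba∈ ab∉ f∈ f-head
    ...   | no ¬head-a = attach-head-new ba∈ ab∉ ¬head-a

  outside : List V → ℕ
  outside Vs = count (λ v → ¬? (v ∈? Vs)) (allFin (n G))

  outside-∷ : ∀ {b Vs} → b ∉ Vs → outside Vs ≡ suc (outside (b ∷ Vs))
  outside-∷ {b} {Vs} b∉ = begin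
    outside Vs
      ≡⟨ count-split (λ v → ¬? (v ∈? Vs)) (_≟ b) (allFin (n G)) ⟩
    count (λ v → ¬? (v ∈? Vs) ×-dec v ≟ b) (allFin (n G)) +
    count (λ v → ¬? (v ∈? Vs) ×-dec ¬? (v ≟ b)) (allFin (n G))
      ≡⟨ cong₂ _+_ (trans (count-cong _ (_≟ b) (allFin (n G)) (λ _ → proj₂) (λ { _ refl → b∉ , refl }))
                          (count-≡ _≟_ (Unique.allFin⁺ (n G)) (∈-allFin b)))
                   (count-cong _ _ (allFin (n G))
                     (λ _ (v∉ , v≢b) → λ { (here v≡b) → v≢b v≡b ; (there v∈) → v∉ v∈ })
                     (λ _ v∉ → v∉ ∘ there , v∉ ∘ here)) ⟩
    1 + outside (b ∷ Vs)
      ∎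
    where
    open ≡-Reasoning

  crossing : ∀ {Vs x u} → UWalk (E G) x u → x ∈ Vs → u ∉ Vs →
             ∃[ a ] ∃[ b ] (a ∈ Vs × b ∉ Vs × Adj (E G) a b)
  crossing here                      x∈ u∉ = ⊥-elim (u∉ x∈)
  crossing {Vs} (step {v = y} xy W) x∈ u∉ with y ∈? Vs
  ... | yes y∈ = crossing W y∈ u∉
  ... | no  y∉ = _ , y , x∈ , y∉ , xy

  module _ (k′ : ℕ) where
    private
      k : ℕ
      k = suc k′

    flows : List Ed → ℕ
    flows T = count (λ v → flowing? T (lookup v)) (allVecs k (n G))

    -- Each vertex outside the subtree contributes a free factor k.
    FlowCount : Subtree → Set
    FlowCount g = flows (Subtree.T g) ≡ k ^ outside (Subtree.Vs g) * (k * k′ ^ ρ (Subtree.T g))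

    count-holds : ∀ κ x → count (λ i → holds? κ i x) (allFin k) ≡ k′ ^ growth κ
    count-holds same     x = count-≡ _≟_ (Unique.allFin⁺ k) (∈-allFin x)
    count-holds distinct x = trans (count-≢ _≟_ (Unique.allFin⁺ k) (∈-allFin x))
                                   (trans (cong (_∸ 1) (length-tabulate {n = k} id)) (sym (ℕ.*-identityʳ k′)))

    start-flowCount : FlowCount start
    start-flowCount = begin
      flows []                            ≡⟨ count-all _ (allVecs k (n G)) (λ _ → (λ ()) , (λ ()) , (λ ())) ⟩
      length (allVecs k (n G))            ≡⟨ length-allVecs k (n G) ⟩
      k ^ n G                             ≡⟨ cong (k ^_) (sym (ℕ.m∸n+n≡m nonempty)) ⟩
      k ^ (n G ∸ 1 + 1)                   ≡⟨ ℕ.^-distribˡ-+-* k (n G ∸ 1) 1 ⟩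
      k ^ (n G ∸ 1) * (k * 1)             ≡⟨ cong (λ o → k ^ o * (k * 1)) (sym outside-root) ⟩
      k ^ outside [ root ] * (k * k′ ^ 0) ∎
      where
      open ≡-Reasoning
      outside-root : outside [ root ] ≡ n G ∸ 1
      outside-root = trans (count-cong _ (λ v → ¬? (v ≟ root)) (allFin (n G))
                                        (λ _ v∉ v≡ → v∉ (here v≡)) (λ { _ v≢ (here v≡) → v≢ v≡ }))
                           (trans (count-≢ _≟_ (Unique.allFin⁺ (n G)) (∈-allFin root))
                                  (cong (_∸ 1) (length-tabulate {n = n G} id)))

    module _ (g : Subtree) {a b : V} (a∈ : a ∈ Subtree.Vs g) (b∉ : b ∉ Subtree.Vs g) (ab : Adj (E G) a b)
      where
      open Subtree g
      open Attach g a∈ b∉ ab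

      extend-flowCount : (att : Attachment) → FlowCount g → FlowCount (extend att)
      extend-flowCount att flowCount = ℕ.*-cancelʳ-≡ _ _ k (begin
        flows (new ++ T) * k
          ≡⟨ cong (_* k) (count-cong _ _ (allVecs k (n G)) (λ _ → flowing⇒) (λ _ → uncurry flowing⇐)) ⟩
        count (λ v → flowing? T (lookup v) ×-dec holds? constraint (lookup v b) (lookup v anchor))
              (allVecs k (n G)) * k
          ≡⟨ count-constrained (n G) b (λ v → flowing? T (lookup v)) (λ v → lookup v anchor) (holds? constraint) _
               (count-holds constraint)
               (λ agree → flowing-agree (λ e∈ → agree _ (tail≢b e∈) , agree _ (head≢b e∈)))
               (λ agree → agree anchor (∈Vs⇒≢b anchor∈)) ⟩
        j * flows T
          ≡⟨ cong (j *_) flowCount ⟩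
        j * (k ^ outside Vs * (k * k′ ^ ρ T))
          ≡⟨ cong (λ o → j * (k ^ o * (k * k′ ^ ρ T))) (outside-∷ b∉) ⟩
        j * (k * k ^ outside (b ∷ Vs) * (k * k′ ^ ρ T))
          ≡⟨ solve 4 (λ j k o r → j :* (k :* o :* (k :* r)) := o :* (k :* (j :* r)) :* k)
                     refl j k (k ^ outside (b ∷ Vs)) (k′ ^ ρ T) ⟩
        k ^ outside (b ∷ Vs) * (k * (j * k′ ^ ρ T)) * k
          ≡⟨ cong (λ r → k ^ outside (b ∷ Vs) * (k * r) * k)
                  (trans (cong (k′ ^_) ρ-growth) (ℕ.^-distribˡ-+-* k′ (growth constraint) (ρ T))) ⟨
        k ^ outside (b ∷ Vs) * (k * k′ ^ ρ (new ++ T)) * k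
          ∎)
        where
        open Attachment att
        open ≡-Reasoning
        open +-*-Solver
        j : ℕ
        j = k′ ^ growth constraint

    flows-whole : ∀ o (g : Subtree) → outside (Subtree.Vs g) ≡ o → FlowCount g → flows (E G) ≡ k * k′ ^ ρ (E G)
    flows-whole zero g none-outside flowCount = begin
      flows (E G)                       ≡⟨ count-cong _ _ (allVecs k (n G)) (λ _ → flowing-⊆ T⊆E) (λ _ → flowing-⊆ E⊆T) ⟩
      flows T                           ≡⟨ flowCount ⟩
      k ^ outside Vs * (k * k′ ^ ρ T)   ≡⟨ cong (λ o → k ^ o * (k * k′ ^ ρ T)) none-outside ⟩
      1 * (k * k′ ^ ρ T)                ≡⟨ ℕ.*-identityˡ _ ⟩
      k * k′ ^ ρ T                      ≡⟨ cong (λ r → k * k′ ^ r) (ρ-cong T⊆E id T⊆E E⊆T) ⟩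
      k * k′ ^ ρ (E G)                  ∎
      where
      open ≡-Reasoning
      open Subtree g
      inside : ∀ v → v ∈ Vs
      inside v = decidable-stable (v ∈? Vs) (count≡0⇒¬ _ (allFin (n G)) none-outside (∈-allFin v))
      E⊆T : E G ⊆ˢ T
      E⊆T e∈ = T-induced e∈ (inside _) (inside _)
    flows-whole (suc o) g some-outside flowCount
      with u , _ , u∉ ← count≡suc⇒∃ _ (allFin (n G)) some-outside
      with a , b , a∈ , b∉ , ab ← crossing (connected root u) (Subtree.root∈ g) u∉
      = flows-whole o (Attach.extend g a∈ b∉ ab att) (ℕ.suc-injective (trans (sym (outside-∷ b∉)) some-outside))
                      (extend-flowCount g a∈ b∉ ab att flowCount)
      where
      att : Attach.Attachment g a∈ b∉ ab
      att = Attach.attachment g a∈ b∉ ab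

  τ-suc : ∀ k′ → τ G (suc k′) ≡ suc k′ * k′ ^ ρ (E G)
  τ-suc k′ = begin
    τ G (suc k′)            ≡⟨ count-cong _ _ (allVecs _ (n G)) (λ _ → FlowingAll⇒Flowing) (λ _ → Flowing⇒FlowingAll) ⟩
    flows k′ (E G)          ≡⟨ flows-whole k′ _ start refl (start-flowCount k′) ⟩
    suc k′ * k′ ^ ρ (E G)   ∎
    where
    open ≡-Reasoning

  τ-zero : τ G 0 ≡ 0
  τ-zero = count-none _ (allVecs 0 (n G)) (λ {v} _ _ → ¬Fin0 (lookup v root))

open import Data.Integer using (+_; -_; _*_; _-_; _^_)
import Data.Integer.Properties as ℤ
open import Data.Integer.Solver using () renaming (module +-*-Solver to ℤ-Solver)

theorem5p10 : (G : Digraph) → IsMPTree G →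
    (r : List (Edge (n G)) → ℕ) → IsMultipathRank G r →
    (k : ℕ) →
    (+ k) * tutte G r (+ 1 - + k) (+ 0) ≡ ((- + 1) ^ r (E G)) * (+ τ G k)
theorem5p10 G mpt r rank zero = begin
  + 0                        ≡⟨ ℤ.*-zeroʳ (sign (r (E G))) ⟨
  sign (r (E G)) * + 0       ≡⟨ cong (λ t → sign (r (E G)) * + t) τ-zero ⟨
  sign (r (E G)) * + τ G 0   ∎
  where
  open ≡-Reasoning
  open FlowingColourings G mpt
theorem5p10 G mpt r rank (suc k′) = begin
  + suc k′ * tutte G r (+ 1 - + suc k′) (+ 0)
    ≡⟨ cong (+ suc k′ *_) (tutte-at-1-k r rank (suc k′)) ⟩
  + suc k′ * (sign (ρ (E G)) * (+ k′) ^ ρ (E G))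
    ≡⟨ solve 3 (λ k s p → k :* (s :* p) := s :* (k :* p)) refl (+ suc k′) (sign (ρ (E G))) ((+ k′) ^ ρ (E G)) ⟩
  sign (ρ (E G)) * (+ suc k′ * (+ k′) ^ ρ (E G))
    ≡⟨ cong₂ (λ a t → sign a * t) (rank≡ρ r rank (E G) ⊆-refl)
             (trans (ℤ.pos-* (suc k′) _) (cong (+ suc k′ *_) (pos-^ k′ (ρ (E G))))) ⟨
  sign (r (E G)) * + (suc k′ ℕ.* k′ ℕ.^ ρ (E G))
    ≡⟨ cong (λ t → sign (r (E G)) * + t) (τ-suc k′) ⟨
  sign (r (E G)) * + τ G (suc k′)
    ∎
  where
  open ≡-Reasoning
  open MultipathMatroid G mpt
  open FlowingColourings G mpt
  open ℤ-Solver
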